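{- The class of unit-distance graphs is $(6,1)$-disjointness-expressing.
   Context: All graphs are finite, simple and connected. A unit-distance graph has as vertices distinct points of the plane, two points being adjacent iff their Euclidean distance is exactly $1$. $N[S]$ denotes the closed neighbourhood of a vertex set $S$. A class $\mathcal{C}$ is $(s,\kappa)$-disjointness-expressing if for some constant $\alpha>0$, for every positive integer $N$ and every $X\subseteq\{1,\dots,N\}$ one can define graphs $L(X)$ and $R(X)$, each containing a labelled set $S$ of special vertices, such that for all $A,B\subseteq\{1,\dots,N\}$: (i) the graph $g(L(A),R(B))$ obtained by identifying each vertex of $S$ in $L(A)$ with the corresponding vertex of $S$ in $R(B)$ is connected and has at most $\alpha N^{1/\kappa}$ vertices; (ii) the subgraph of $g(L(A),R(B))$ induced by $N[S]$ is independent of $A$ and $B$ (for all $A,A',B,B'$ there is an isomorphism between the corresponding induced subgraphs that is the identity on $S$) and has at most $s$ vertices; (iii) $g(L(A),R(B))\in\mathcal{C}$ if and only if $A\cap B=\emptyset$. -}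

module Defs where

open import Level using (0ℓ)
open import Data.Bool using (Bool; true; false; _∨_)
open import Data.Nat using (ℕ; zero; suc; _+_; _*_; _^_; _≤_; _<_)
open import Data.Fin using (Fin)
open import Data.Fin.Properties using (+↔⊎)
open import Data.Fin.Subset using (Subset; _∩_; Empty)
open import Data.Sum using (_⊎_; inj₁; inj₂)
open import Data.Sum.Function.Propositional using (_⊎-↔_)
open import Data.Product using (Σ; _×_; _,_; proj₁; proj₂; ∃)
open import Data.Empty using (⊥)
open import Relation.Nullary using (¬_)
open import Relation.Binary.PropositionalEquality using (_≡_; _≢_; refl)
open import Relation.Binary.Structures using (IsTotalOrder)
open import Algebra.Structures using (IsCommutativeRing)
open import Function using (_↔_; _↣_; Inverse; _⇔_)
open import Function.Construct.Composition using (_↔-∘_)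
open import Function.Construct.Identity using (↔-id)

-- The real numbers, axiomatised as a complete ordered field
-- (every model is isomorphic to ℝ; agda-stdlib has no reals).

record CompleteOrderedField : Set₁ where
  infixl 6 _+ᴿ_ _-ᴿ_
  infixl 7 _*ᴿ_
  infix 4 _≤ᴿ_
  field
    Carrier : Set
    _+ᴿ_ _*ᴿ_ : Carrier → Carrier → Carrier
    -ᴿ_ : Carrier → Carrier
    0ᴿ 1ᴿ : Carrier
    _≤ᴿ_ : Carrier → Carrier → Set
    isCommutativeRing : IsCommutativeRing _≡_ _+ᴿ_ _*ᴿ_ -ᴿ_ 0ᴿ 1ᴿ
    0≢1 : 0ᴿ ≢ 1ᴿ
    inverse : ∀ x → x ≢ 0ᴿ → Σ Carrier (λ y → x *ᴿ y ≡ 1ᴿ)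
    isTotalOrder : IsTotalOrder _≡_ _≤ᴿ_
    +-mono : ∀ {x y} z → x ≤ᴿ y → x +ᴿ z ≤ᴿ y +ᴿ z
    *-nonneg : ∀ {x y} → 0ᴿ ≤ᴿ x → 0ᴿ ≤ᴿ y → 0ᴿ ≤ᴿ x *ᴿ y
    sup : (P : Carrier → Set) → Σ Carrier P →
          Σ Carrier (λ b → ∀ x → P x → x ≤ᴿ b) →
          Σ Carrier (λ s → (∀ x → P x → x ≤ᴿ s) ×
                           (∀ b → (∀ x → P x → x ≤ᴿ b) → s ≤ᴿ b))
  _-ᴿ_ : Carrier → Carrier → Carrier
  x -ᴿ y = x +ᴿ (-ᴿ y)

record Graph : Set₁ where
  field
    V      : Set
    size   : ℕ
    enum   : Fin size ↔ V
    adj    : V → V → Bool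
    sym    : ∀ u v → adj u v ≡ adj v u
    irrefl : ∀ v → adj v v ≡ false

data Walk (G : Graph) : Graph.V G → Graph.V G → Set where
  here : ∀ {v} → Walk G v v
  step : ∀ {u w v} → Graph.adj G u w ≡ true → Walk G w v → Walk G u v

Connected : Graph → Set
Connected G = ∀ u v → Walk G u v

-- Unit-distance graphs (in the plane ℝ × ℝ, ℝ a complete ordered field).
-- Distance exactly 1 ⇔ squared distance exactly 1 (distances are ≥ 0).

module _ (ℝ : CompleteOrderedField) where
  open CompleteOrderedField ℝ

  sqDist : Carrier × Carrier → Carrier × Carrier → Carrier
  sqDist (x₁ , y₁) (x₂ , y₂) =
    (x₁ -ᴿ x₂) *ᴿ (x₁ -ᴿ x₂) +ᴿ (y₁ -ᴿ y₂) *ᴿ (y₁ -ᴿ y₂)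

  IsUnitDistance : Graph → Set
  IsUnitDistance G =
    Σ (Graph.V G → Carrier × Carrier) λ p →
      (∀ u v → p u ≡ p v → u ≡ v) ×
      (∀ u v → (Graph.adj G u v ≡ true) ⇔ (sqDist (p u) (p v) ≡ 1ᴿ))

-- Graphs with k labelled special vertices: vertex set Fin k ⊎ Fin m,
-- where inj₁ i is the special vertex with label i.

record LGraph (k : ℕ) : Set where
  field
    m      : ℕ
    adj    : Fin k ⊎ Fin m → Fin k ⊎ Fin m → Bool
    sym    : ∀ u v → adj u v ≡ adj v u
    irrefl : ∀ v → adj v v ≡ false

-- g(L , R): identify the special vertices with equal labels.
module _ {k : ℕ} (L R : LGraph k) where
  private
    module L = LGraph L
    module R = LGraph R

  GV : Set
  GV = Fin k ⊎ (Fin L.m ⊎ Fin R.m)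

  gAdj : GV → GV → Bool
  gAdj (inj₁ i) (inj₁ j) = L.adj (inj₁ i) (inj₁ j) ∨ R.adj (inj₁ i) (inj₁ j)
  gAdj (inj₁ i) (inj₂ (inj₁ a)) = L.adj (inj₁ i) (inj₂ a)
  gAdj (inj₁ i) (inj₂ (inj₂ b)) = R.adj (inj₁ i) (inj₂ b)
  gAdj (inj₂ (inj₁ a)) (inj₁ j) = L.adj (inj₂ a) (inj₁ j)
  gAdj (inj₂ (inj₂ b)) (inj₁ j) = R.adj (inj₂ b) (inj₁ j)
  gAdj (inj₂ (inj₁ a)) (inj₂ (inj₁ a′)) = L.adj (inj₂ a) (inj₂ a′)
  gAdj (inj₂ (inj₂ b)) (inj₂ (inj₂ b′)) = R.adj (inj₂ b) (inj₂ b′)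
  gAdj (inj₂ (inj₁ a)) (inj₂ (inj₂ b)) = false
  gAdj (inj₂ (inj₂ b)) (inj₂ (inj₁ a)) = false

  private
    gSym : ∀ u v → gAdj u v ≡ gAdj v u
    gSym (inj₁ i) (inj₁ j) rewrite L.sym (inj₁ i) (inj₁ j) | R.sym (inj₁ i) (inj₁ j) = refl
    gSym (inj₁ i) (inj₂ (inj₁ a)) = L.sym _ _
    gSym (inj₁ i) (inj₂ (inj₂ b)) = R.sym _ _
    gSym (inj₂ (inj₁ a)) (inj₁ j) = L.sym _ _
    gSym (inj₂ (inj₂ b)) (inj₁ j) = R.sym _ _
    gSym (inj₂ (inj₁ a)) (inj₂ (inj₁ a′)) = L.sym _ _
    gSym (inj₂ (inj₂ b)) (inj₂ (inj₂ b′)) = R.sym _ _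
    gSym (inj₂ (inj₁ a)) (inj₂ (inj₂ b)) = refl
    gSym (inj₂ (inj₂ b)) (inj₂ (inj₁ a)) = refl

    gIrr : ∀ v → gAdj v v ≡ false
    gIrr (inj₁ i) rewrite L.irrefl (inj₁ i) | R.irrefl (inj₁ i) = refl
    gIrr (inj₂ (inj₁ a)) = L.irrefl _
    gIrr (inj₂ (inj₂ b)) = R.irrefl _

  glue : Graph
  glue = record
    { V = GV
    ; size = k + (L.m + R.m)
    ; enum = (↔-id (Fin k) ⊎-↔ +↔⊎) ↔-∘ +↔⊎
    ; adj = gAdj
    ; sym = gSym
    ; irrefl = gIrr
    }

anyFin : (k : ℕ) → (Fin k → Bool) → Bool
anyFin zero    f = false
anyFin (suc k) f = f Fin.zero ∨ anyFin k (λ i → f (Fin.suc i))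

module _ {k : ℕ} (L R : LGraph k) where
  inNS : GV L R → Bool
  inNS (inj₁ i) = true
  inNS v        = anyFin k (λ i → gAdj L R (inj₁ i) v)

  NSV : Set
  NSV = Σ (GV L R) (λ v → inNS v ≡ true)

  special : Fin k → NSV
  special i = inj₁ i , refl

NSIso : {k : ℕ} (L R L′ R′ : LGraph k) → Set
NSIso L R L′ R′ =
  Σ (NSV L R ↔ NSV L′ R′) λ f →
    (∀ x y → gAdj L′ R′ (proj₁ (Inverse.to f x)) (proj₁ (Inverse.to f y))
             ≡ gAdj L R (proj₁ x) (proj₁ y)) ×
    (∀ i → Inverse.to f (special L R i) ≡ special L′ R′ i)

-- Subsets of {1,…,N} are Subset N (indices Fin N).
-- The real constant α > 0 may be taken to be a positive natural number;
-- |V| ≤ α N^{1/κ}  is written  |V|^κ ≤ α^κ N.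

DisjointnessExpressing : (Graph → Set) → ℕ → ℕ → Set
DisjointnessExpressing C s κ =
  Σ ℕ λ α → 0 < α ×
  (∀ N → 0 < N →
    Σ ℕ λ k → Σ (Subset N → LGraph k) λ L → Σ (Subset N → LGraph k) λ R →
      ∀ A B →
        (Connected (glue (L A) (R B)) ×
         Graph.size (glue (L A) (R B)) ^ κ ≤ α ^ κ * N) ×
        ((∀ A′ B′ → NSIso (L A) (R B) (L A′) (R B′)) ×
         (NSV (L A) (R B) ↣ Fin s)) ×
        (C (glue (L A) (R B)) ⇔ Empty (A ∩ B)))

-- L(X) and R(X) are two copies of one graph G X, glued along its two special
-- vertices s and t: a strip of equilateral triangles hanging below st, and
-- for each i a three-vertex gadget attached to the strip, folded towards st
-- if i ∈ X and away from it otherwise.  In a unit-distance realisation the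
-- rhombus lemma forces every vertex of the strip, and of the folded gadgets,
-- onto the affine image of the triangular lattice spanned by s, t and the
-- first vertex below them.  The tip of a folded gadget then lies on the line
-- st, so for i ∈ A ∩ B the tips of gadget i in the two copies coincide.
-- Conversely, if A ∩ B = ∅, put one copy in the triangular lattice below st
-- and the other at its mirror image above st: vertices of different copies
-- could only come within distance 1 at the tips of common gadgets.

module Submission where

open import Defs
open import Data.Bool using (Bool; true; false; _∨_)
open import Data.Empty using (⊥-elim)
open import Data.Fin as Fin using (Fin; toℕ; fromℕ<)
import Data.Fin.Properties as FinP
open import Data.Fin.Subset using (Subset; _∩_; Empty)
open import Data.Nat as ℕ using (ℕ; zero; suc; z≤n; s≤s; _<_)
import Data.Nat.Properties as ℕP
open import Data.Product using (Σ; _×_; _,_; proj₁; proj₂)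
open import Data.Sum using (_⊎_; inj₁; inj₂)
open import Data.Vec using (lookup)
open import Function using (_∘_; _↔_; _↣_; _⇔_; Inverse; Equivalence; mk⇔; mk↣; mk↔ₛ′)
open import Relation.Binary.PropositionalEquality
open import Relation.Nullary using (¬_; does; yes; no)

module Lattice where
  open import Data.Integer as ℤ using (ℤ; +_; _⊖_; ∣_∣)
  import Data.Integer.Properties as ℤP
  open import Data.Integer.Solver using (module +-*-Solver)
  import Data.Sign.Properties as SignP
  open import Relation.Nullary.Decidable using (dec-true; dec-false)

  open +-*-Solver using (solve; _:+_; _:*_; _:-_; :-_; _:=_; con; Polynomial)

  -- A ℤ × ℤ is the point A (1 , 0) + B (1/2 , √3/2) of the triangular
  -- lattice; norm A B is its squared Euclidean length.
  norm : ℤ → ℤ → ℤ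
  norm A B = A ℤ.* A ℤ.+ A ℤ.* B ℤ.+ B ℤ.* B

  dist² : ℤ × ℤ → ℤ × ℤ → ℤ
  dist² (A , B) (A′ , B′) = norm (A ℤ.- A′) (B ℤ.- B′)

  private
    :norm : ∀ {n} → Polynomial n → Polynomial n → Polynomial n
    :norm A B = A :* A :+ A :* B :+ B :* B

  dist²-sym : ∀ u v → dist² u v ≡ dist² v u
  dist²-sym (A , B) (A′ , B′) =
    solve 4 (λ A B A′ B′ → :norm (A :- A′) (B :- B′) := :norm (A′ :- A) (B′ :- B)) refl A B A′ B′

  dist²-self : ∀ u → dist² u u ≡ + 0
  dist²-self (A , B) = solve 2 (λ A B → :norm (A :- A) (B :- B) := con (+ 0)) refl A B

  norm-double : ∀ A B → norm (A ℤ.+ A) (B ℤ.+ B) ≡ + 4 ℤ.* norm A B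
  norm-double = solve 2 (λ A B → :norm (A :+ A) (B :+ B) := con (+ 4) :* :norm A B) refl

  -- A cell (a , d) is column a and depth d.  The right copy of a graph
  -- puts it at depth d below the line B = 0, the left copy at its mirror
  -- image: the reflection in B = 0 is (A , B) ↦ (A + B , - B).
  Cell : Set
  Cell = ℕ × ℕ

  placeR : Cell → ℤ × ℤ
  placeR (a , d) = (+ a , ℤ.- + d)

  placeL : Cell → ℤ × ℤ
  placeL (a , d) = (+ a ℤ.- + d , + d)

  placeR-injective : ∀ c c′ → placeR c ≡ placeR c′ → c ≡ c′
  placeR-injective (a , d) (a′ , d′) eq =
    cong₂ _,_ (ℤP.+-injective (cong proj₁ eq)) (ℤP.+-injective (ℤP.neg-injective (cong proj₂ eq)))

  placeL-injective : ∀ c c′ → placeL c ≡ placeL c′ → c ≡ c′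
  placeL-injective (a , d) (a′ , d′) eq = cong₂ _,_ (ℤP.+-injective +a≡+a′) d≡d′
    where
    d≡d′ : d ≡ d′
    d≡d′ = ℤP.+-injective (cong proj₂ eq)
    +a≡+a′ : + a ≡ + a′
    +a≡+a′ = begin
      + a                    ≡⟨ solve 2 (λ a d → a := (a :- d) :+ d) refl (+ a) (+ d) ⟩
      (+ a ℤ.- + d) ℤ.+ + d  ≡⟨ cong₂ ℤ._+_ (cong proj₁ eq) (cong +_ d≡d′) ⟩
      (+ a′ ℤ.- + d′) ℤ.+ + d′ ≡⟨ solve 2 (λ a d → (a :- d) :+ d := a) refl (+ a′) (+ d′) ⟩
      + a′                   ∎
      where open ≡-Reasoning

  dist²-placeL : ∀ c c′ → dist² (placeL c) (placeL c′) ≡ dist² (placeR c) (placeR c′)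
  dist²-placeL (a , d) (a′ , d′) =
    solve 4 (λ a d a′ d′ → :norm ((a :- d) :- (a′ :- d′)) (d :- d′) := :norm (a :- a′) ((:- d) :- (:- d′)))
      refl (+ a) (+ d) (+ a′) (+ d′)

  -- Opaque, so that the cells can be read off a goal unitAdj c c′ ≡ b.
  opaque
    unitAdj : Cell → Cell → Bool
    unitAdj c c′ = does (dist² (placeR c) (placeR c′) ℤP.≟ + 1)

    unitAdj⇒dist²≡1 : ∀ c c′ → unitAdj c c′ ≡ true → dist² (placeR c) (placeR c′) ≡ + 1
    unitAdj⇒dist²≡1 c c′ adj with dist² (placeR c) (placeR c′) ℤP.≟ + 1
    ... | yes d≡1 = d≡1

    dist²≡1⇒unitAdj : ∀ c c′ → dist² (placeR c) (placeR c′) ≡ + 1 → unitAdj c c′ ≡ true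
    dist²≡1⇒unitAdj c c′ = dec-true (dist² (placeR c) (placeR c′) ℤP.≟ + 1)

    dist²≢1⇒¬unitAdj : ∀ c c′ → dist² (placeR c) (placeR c′) ≢ + 1 → unitAdj c c′ ≡ false
    dist²≢1⇒¬unitAdj c c′ = dec-false (dist² (placeR c) (placeR c′) ℤP.≟ + 1)

    unitAdj-sym : ∀ c c′ → unitAdj c c′ ≡ unitAdj c′ c
    unitAdj-sym c c′ rewrite dist²-sym (placeR c) (placeR c′) = refl

    unitAdj-irrefl : ∀ c → unitAdj c c ≡ false
    unitAdj-irrefl c rewrite dist²-self (placeR c) = refl

  adj-E : ∀ a d → unitAdj (suc a , d) (a , d) ≡ true
  adj-E a d = dist²≡1⇒unitAdj _ _
    (solve 2 (λ a d → :norm ((con (+ 1) :+ a) :- a) ((:- d) :- (:- d)) := con (+ 1)) refl (+ a) (+ d))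

  adj-S : ∀ a d → unitAdj (a , d) (a , suc d) ≡ true
  adj-S a d = dist²≡1⇒unitAdj _ _
    (solve 2 (λ a d → :norm (a :- a) ((:- d) :- (:- (con (+ 1) :+ d))) := con (+ 1)) refl (+ a) (+ d))

  adj-SE : ∀ a d → unitAdj (a , d) (suc a , suc d) ≡ true
  adj-SE a d = dist²≡1⇒unitAdj _ _
    (solve 2 (λ a d → :norm (a :- (con (+ 1) :+ a)) ((:- d) :- (:- (con (+ 1) :+ d))) := con (+ 1))
      refl (+ a) (+ d))

  adj-W : ∀ a d → unitAdj (a , d) (suc a , d) ≡ true
  adj-W a d = trans (unitAdj-sym _ _) (adj-E a d)

  adj-N : ∀ a d → unitAdj (a , suc d) (a , d) ≡ true
  adj-N a d = trans (unitAdj-sym _ _) (adj-S a d)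

  adj-NW : ∀ a d → unitAdj (suc a , suc d) (a , d) ≡ true
  adj-NW a d = trans (unitAdj-sym _ _) (adj-SE a d)

  infixl 6 _⊕_
  _⊕_ : Cell → Cell → Cell
  (a , d) ⊕ (a′ , d′) = (a ℕ.+ a′ , d ℕ.+ d′)

  ⊕-comm : ∀ c c′ → c ⊕ c′ ≡ c′ ⊕ c
  ⊕-comm (a , d) (a′ , d′) = cong₂ _,_ (ℕP.+-comm a a′) (ℕP.+-comm d d′)

  private
    ⊕-col : ∀ c₁ c₂ c₃ c₄ → c₁ ⊕ c₂ ≡ c₃ ⊕ c₄ → + proj₁ c₁ ℤ.+ + proj₁ c₂ ≡ + proj₁ c₃ ℤ.+ + proj₁ c₄
    ⊕-col _ _ _ _ eq = cong (λ c → + proj₁ c) eq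

    ⊕-row : ∀ c₁ c₂ c₃ c₄ → c₁ ⊕ c₂ ≡ c₃ ⊕ c₄ → + proj₂ c₁ ℤ.+ + proj₂ c₂ ≡ + proj₂ c₃ ℤ.+ + proj₂ c₄
    ⊕-row _ _ _ _ eq = cong (λ c → + proj₂ c) eq

    sum⇒diff : ∀ x₁ x₂ x₃ x₄ → x₁ ℤ.+ x₂ ≡ x₃ ℤ.+ x₄ → x₁ ℤ.- x₃ ≡ x₄ ℤ.- x₂
    sum⇒diff x₁ x₂ x₃ x₄ eq = begin
      x₁ ℤ.- x₃                             ≡⟨ solve 4 (λ x₁ x₂ x₃ x₄ → x₁ :- x₃ := (x₁ :+ x₂) :- (x₃ :+ x₄) :+ (x₄ :- x₂))
                                                 refl x₁ x₂ x₃ x₄ ⟩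
      (x₁ ℤ.+ x₂) ℤ.- (x₃ ℤ.+ x₄) ℤ.+ (x₄ ℤ.- x₂) ≡⟨ cong (ℤ._+ (x₄ ℤ.- x₂)) (ℤP.i≡j⇒i-j≡0 eq) ⟩
      + 0 ℤ.+ (x₄ ℤ.- x₂)                   ≡⟨ ℤP.+-identityˡ _ ⟩
      x₄ ℤ.- x₂                             ∎
      where open ≡-Reasoning

    neg-sum : ∀ x₁ x₂ x₃ x₄ → x₁ ℤ.+ x₂ ≡ x₃ ℤ.+ x₄ → ℤ.- x₁ ℤ.+ ℤ.- x₂ ≡ ℤ.- x₃ ℤ.+ ℤ.- x₄
    neg-sum x₁ x₂ x₃ x₄ eq =
      trans (sym (ℤP.neg-distrib-+ x₁ x₂)) (trans (cong ℤ.-_ eq) (ℤP.neg-distrib-+ x₃ x₄))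

    mid⇒diff : ∀ x₁ x₂ x → x₁ ℤ.+ x₂ ≡ x ℤ.+ x → x₁ ℤ.- x₂ ≡ (x₁ ℤ.- x) ℤ.+ (x₁ ℤ.- x)
    mid⇒diff x₁ x₂ x eq = begin
      x₁ ℤ.- x₂                    ≡⟨ solve 3 (λ x₁ x₂ x → x₁ :- x₂ := (x :+ x) :- (x₁ :+ x₂) :+ ((x₁ :- x) :+ (x₁ :- x)))
                                        refl x₁ x₂ x ⟩
      (x ℤ.+ x) ℤ.- (x₁ ℤ.+ x₂) ℤ.+ ((x₁ ℤ.- x) ℤ.+ (x₁ ℤ.- x))
                                   ≡⟨ cong (ℤ._+ ((x₁ ℤ.- x) ℤ.+ (x₁ ℤ.- x))) (ℤP.i≡j⇒i-j≡0 (sym eq)) ⟩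
      + 0 ℤ.+ ((x₁ ℤ.- x) ℤ.+ (x₁ ℤ.- x)) ≡⟨ ℤP.+-identityˡ _ ⟩
      (x₁ ℤ.- x) ℤ.+ (x₁ ℤ.- x)    ∎
      where open ≡-Reasoning

    dist²-parallelogram : ∀ c₁ c₂ c₃ c₄ → c₁ ⊕ c₂ ≡ c₃ ⊕ c₄ →
                          dist² (placeR c₁) (placeR c₃) ≡ dist² (placeR c₄) (placeR c₂)
    dist²-parallelogram (a₁ , d₁) (a₂ , d₂) (a₃ , d₃) (a₄ , d₄) eq =
      cong₂ norm (sum⇒diff (+ a₁) (+ a₂) (+ a₃) (+ a₄) (⊕-col (a₁ , d₁) (a₂ , d₂) (a₃ , d₃) (a₄ , d₄) eq))
                 (sum⇒diff (ℤ.- + d₁) (ℤ.- + d₂) (ℤ.- + d₃) (ℤ.- + d₄)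
                           (neg-sum (+ d₁) (+ d₂) (+ d₃) (+ d₄) (⊕-row (a₁ , d₁) (a₂ , d₂) (a₃ , d₃) (a₄ , d₄) eq)))

    dist²-midpoint : ∀ c c₁ c₂ → c₁ ⊕ c₂ ≡ c ⊕ c →
                     dist² (placeR c₁) (placeR c₂) ≡ + 4 ℤ.* dist² (placeR c₁) (placeR c)
    dist²-midpoint (a , d) (a₁ , d₁) (a₂ , d₂) eq =
      trans (cong₂ norm (mid⇒diff (+ a₁) (+ a₂) (+ a) (⊕-col (a₁ , d₁) (a₂ , d₂) (a , d) (a , d) eq))
                        (mid⇒diff (ℤ.- + d₁) (ℤ.- + d₂) (ℤ.- + d)
                                  (neg-sum (+ d₁) (+ d₂) (+ d) (+ d) (⊕-row (a₁ , d₁) (a₂ , d₂) (a , d) (a , d) eq))))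
            (norm-double (+ a₁ ℤ.- + a) (ℤ.- + d₁ ℤ.- ℤ.- + d))

  opaque
    unfolding unitAdj

    unitAdj-parallelogram : ∀ c₁ c₂ c₃ c₄ → c₁ ⊕ c₂ ≡ c₃ ⊕ c₄ → unitAdj c₁ c₃ ≡ unitAdj c₄ c₂
    unitAdj-parallelogram c₁ c₂ c₃ c₄ eq rewrite dist²-parallelogram c₁ c₂ c₃ c₄ eq = refl

  unitAdj-midpoint : ∀ c c₁ c₂ → c₁ ⊕ c₂ ≡ c ⊕ c → unitAdj c₁ c ≡ true → unitAdj c₁ c₂ ≡ false
  unitAdj-midpoint c c₁ c₂ eq adj = dist²≢1⇒¬unitAdj c₁ c₂ (λ d≡1 → 4≢1 (begin
    + 4                                      ≡⟨ sym (cong (+ 4 ℤ.*_) (unitAdj⇒dist²≡1 c₁ c adj)) ⟩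
    + 4 ℤ.* dist² (placeR c₁) (placeR c)      ≡⟨ sym (dist²-midpoint c c₁ c₂ eq) ⟩
    dist² (placeR c₁) (placeR c₂)            ≡⟨ d≡1 ⟩
    + 1                                      ∎))
    where
    open ≡-Reasoning
    4≢1 : + 4 ≢ + 1
    4≢1 ()

  private
    sq≡∣∣² : ∀ i → i ℤ.* i ≡ + (∣ i ∣ ℕ.* ∣ i ∣)
    sq≡∣∣² i rewrite SignP.s*s≡+ (ℤ.sign i) = ℤP.+◃n≡+n _

    sum-of-squares≡2 : ∀ x y z → x ℕ.* x ℕ.+ y ℕ.* y ℕ.+ z ℕ.* z ≡ 2 → x ℕ.≤ 1
    sum-of-squares≡2 zero          y z _ = z≤n
    sum-of-squares≡2 (suc zero)    y z _ = s≤s z≤n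
    sum-of-squares≡2 (suc (suc k)) y z e = ⊥-elim (ℕP.<⇒≱ (s≤s (s≤s (s≤s z≤n))) (begin
      3                                                    ≤⟨ s≤s (s≤s (ℕP.≤-trans (s≤s z≤n) (ℕP.m≤n+m _ k))) ⟩
      suc (suc k) ℕ.* suc (suc k)                          ≤⟨ ℕP.m≤m+n _ _ ⟩
      suc (suc k) ℕ.* suc (suc k) ℕ.+ y ℕ.* y              ≤⟨ ℕP.m≤m+n _ _ ⟩
      suc (suc k) ℕ.* suc (suc k) ℕ.+ y ℕ.* y ℕ.+ z ℕ.* z  ≡⟨ e ⟩
      2                                                    ∎))
      where open ℕP.≤-Reasoning

  -- 2 norm A B = A² + B² + (A + B)², so a unit vector has small coordinates.
  norm≡1⇒small : ∀ A B → norm A B ≡ + 1 → ∣ A ∣ ℕ.≤ 1 × ∣ B ∣ ℕ.≤ 1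
  norm≡1⇒small A B n≡1 =
    sum-of-squares≡2 (∣ A ∣) (∣ B ∣) (∣ A ℤ.+ B ∣) squares≡2 ,
    sum-of-squares≡2 (∣ B ∣) (∣ A ∣) (∣ A ℤ.+ B ∣)
      (trans (cong (ℕ._+ (∣ A ℤ.+ B ∣ ℕ.* ∣ A ℤ.+ B ∣)) (ℕP.+-comm (∣ B ∣ ℕ.* ∣ B ∣) _)) squares≡2)
    where
    squares≡2 : ∣ A ∣ ℕ.* ∣ A ∣ ℕ.+ ∣ B ∣ ℕ.* ∣ B ∣ ℕ.+ ∣ A ℤ.+ B ∣ ℕ.* ∣ A ℤ.+ B ∣ ≡ 2
    squares≡2 = ℤP.+-injective (begin
      + (∣ A ∣ ℕ.* ∣ A ∣ ℕ.+ ∣ B ∣ ℕ.* ∣ B ∣ ℕ.+ ∣ A ℤ.+ B ∣ ℕ.* ∣ A ℤ.+ B ∣)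
        ≡⟨ sym (cong₂ ℤ._+_ (cong₂ ℤ._+_ (sq≡∣∣² A) (sq≡∣∣² B)) (sq≡∣∣² (A ℤ.+ B))) ⟩
      A ℤ.* A ℤ.+ B ℤ.* B ℤ.+ (A ℤ.+ B) ℤ.* (A ℤ.+ B)
        ≡⟨ solve 2 (λ A B → A :* A :+ B :* B :+ (A :+ B) :* (A :+ B) := :norm A B :+ :norm A B) refl A B ⟩
      norm A B ℤ.+ norm A B
        ≡⟨ cong₂ ℤ._+_ n≡1 n≡1 ⟩
      + 2 ∎)
      where open ≡-Reasoning

  Near : ℕ → ℕ → Set
  Near x y = x ℕ.≤ suc y × y ℕ.≤ suc x

  private
    ≤-∣⊖∣≤1⇒≤suc : ∀ {m n} → m ℕ.≤ n → ∣ m ⊖ n ∣ ℕ.≤ 1 → n ℕ.≤ suc m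
    ≤-∣⊖∣≤1⇒≤suc {m} {n} m≤n d≤1 = begin
      n                  ≡⟨ sym (ℕP.m+[n∸m]≡n m≤n) ⟩
      m ℕ.+ (n ℕ.∸ m)    ≤⟨ ℕP.+-monoʳ-≤ m (subst (ℕ._≤ 1) (ℤP.∣⊖∣-≤ m≤n) d≤1) ⟩
      m ℕ.+ 1            ≡⟨ ℕP.+-comm m 1 ⟩
      suc m              ∎
      where open ℕP.≤-Reasoning

  ∣⊖∣≤1⇒Near : ∀ x y → ∣ x ⊖ y ∣ ℕ.≤ 1 → Near x y
  ∣⊖∣≤1⇒Near x y d≤1 with ℕP.≤-total x y
  ... | inj₁ x≤y = ℕP.m≤n⇒m≤1+n x≤y , ≤-∣⊖∣≤1⇒≤suc x≤y d≤1
  ... | inj₂ y≤x = ≤-∣⊖∣≤1⇒≤suc y≤x (subst (ℕ._≤ 1) (ℤP.∣m⊖n∣≡∣n⊖m∣ x y) d≤1) , ℕP.m≤n⇒m≤1+n y≤x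

  private
    small⇒Near : ∀ x y {i} → i ≡ x ⊖ y → ∣ i ∣ ℕ.≤ 1 → Near x y
    small⇒Near x y refl = ∣⊖∣≤1⇒Near x y

  unitAdj⇒Near : ∀ {a d a′ d′} → unitAdj (a , d) (a′ , d′) ≡ true → Near a a′ × Near d′ d
  unitAdj⇒Near {a} {d} {a′} {d′} adj with norm≡1⇒small (+ a ℤ.- + a′) (ℤ.- + d ℤ.- ℤ.- + d′) (unitAdj⇒dist²≡1 _ _ adj)
  ... | ∣Δa∣≤1 , ∣Δd∣≤1 =
    small⇒Near a a′ (ℤP.m-n≡m⊖n a a′) ∣Δa∣≤1 ,
    small⇒Near d′ d (trans (cong (ℤ._+_ (ℤ.- + d)) (ℤP.neg-involutive (+ d′))) (ℤP.-m+n≡n⊖m d d′)) ∣Δd∣≤1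

  ¬Near⇒¬unitAdj : ∀ {a d a′ d′} → ¬ (Near a a′ × Near d′ d) → unitAdj (a , d) (a′ , d′) ≡ false
  ¬Near⇒¬unitAdj far = dist²≢1⇒¬unitAdj _ _ (λ d≡1 → far (unitAdj⇒Near (dist²≡1⇒unitAdj _ _ d≡1)))

  -- placeL c and placeR c′ differ by at most 1 in both lattice coordinates.
  CrossNear : Cell → Cell → Set
  CrossNear (a , d) (a′ , d′) = d ℕ.+ d′ ℕ.≤ 1 × Near a (d ℕ.+ a′)

  private
    Δcol-cross : ∀ a d a′ → + a ℤ.- + d ℤ.- + a′ ≡ a ⊖ (d ℕ.+ a′)
    Δcol-cross a d a′ =
      trans (solve 3 (λ a d a′ → a :- d :- a′ := a :- (d :+ a′)) refl (+ a) (+ d) (+ a′)) (ℤP.m-n≡m⊖n a (d ℕ.+ a′))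

    Δrow-cross : ∀ d d′ → + d ℤ.- ℤ.- + d′ ≡ + (d ℕ.+ d′)
    Δrow-cross d d′ = cong (ℤ._+_ (+ d)) (ℤP.neg-involutive (+ d′))

    crossSmall⇒CrossNear : ∀ a d a′ d′ → ∣ + a ℤ.- + d ℤ.- + a′ ∣ ℕ.≤ 1 → ∣ + d ℤ.- ℤ.- + d′ ∣ ℕ.≤ 1 →
                           CrossNear (a , d) (a′ , d′)
    crossSmall⇒CrossNear a d a′ d′ ∣Δa∣≤1 ∣Δd∣≤1 =
      subst (λ i → ∣ i ∣ ℕ.≤ 1) (Δrow-cross d d′) ∣Δd∣≤1 ,
      ∣⊖∣≤1⇒Near a (d ℕ.+ a′) (subst (λ i → ∣ i ∣ ℕ.≤ 1) (Δcol-cross a d a′) ∣Δa∣≤1)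

  dist²≡1⇒CrossNear : ∀ c c′ → dist² (placeL c) (placeR c′) ≡ + 1 → CrossNear c c′
  dist²≡1⇒CrossNear (a , d) (a′ , d′) d≡1 =
    let ∣Δa∣≤1 , ∣Δd∣≤1 = norm≡1⇒small (+ a ℤ.- + d ℤ.- + a′) (+ d ℤ.- ℤ.- + d′) d≡1
    in crossSmall⇒CrossNear a d a′ d′ ∣Δa∣≤1 ∣Δd∣≤1

  placeL≡placeR⇒CrossNear : ∀ c c′ → placeL c ≡ placeR c′ → CrossNear c c′
  placeL≡placeR⇒CrossNear (a , d) (a′ , d′) eq =
    crossSmall⇒CrossNear a d a′ d′ (≡⇒∣-∣≤1 (cong proj₁ eq)) (≡⇒∣-∣≤1 (cong proj₂ eq))
    where
    ≡⇒∣-∣≤1 : ∀ {x y} → x ≡ y → ∣ x ℤ.- y ∣ ℕ.≤ 1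
    ≡⇒∣-∣≤1 x≡y rewrite ℤP.i≡j⇒i-j≡0 x≡y = z≤n

module OrderedField (ℝ : CompleteOrderedField) where
  open import Level using (0ℓ)
  open import Algebra.Bundles using (CommutativeRing)
  import Algebra.Solver.Ring
  import Algebra.Solver.Ring.AlmostCommutativeRing as ACR
  open import Data.Integer as ℤ using (ℤ; -[1+_]; _⊖_; _◃_; sign; ∣_∣) renaming (+_ to pos)
  import Data.Integer.Properties as ℤP
  open import Data.Maybe using (Maybe; just; nothing)
  open import Data.Sign as Sign using (Sign)
  open import Relation.Binary.Bundles using (Poset)
  import Relation.Binary.Reasoning.PartialOrder
  open import Relation.Binary.Structures using (IsTotalOrder)

  open CompleteOrderedField ℝ public
    using (Carrier; 0ᴿ; 1ᴿ; -ᴿ_; 0≢1; inverse; sup)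
    renaming (_+ᴿ_ to _+_; _*ᴿ_ to _*_; _-ᴿ_ to _-_; _≤ᴿ_ to _≤_)
  open CompleteOrderedField ℝ using (isCommutativeRing; isTotalOrder; +-mono; *-nonneg)

  commutativeRing : CommutativeRing 0ℓ 0ℓ
  commutativeRing = record { isCommutativeRing = isCommutativeRing }

  open CommutativeRing commutativeRing public
    using ( +-assoc; +-comm; +-identityˡ; +-identityʳ; *-assoc; *-comm; *-identityˡ; *-identityʳ
          ; zeroˡ; zeroʳ; -‿inverseʳ)
  open CommutativeRing commutativeRing
    using (ring; semiring; +-abelianGroup; +-group; +-commutativeSemigroup; *-commutativeSemigroup)
  open import Algebra.Properties.Ring ring using (-1*x≈-x; -‿distribˡ-*; -‿distribʳ-*)
  open import Algebra.Properties.AbelianGroup +-abelianGroup using (⁻¹-∙-comm)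
  open import Algebra.Properties.CommutativeSemigroup +-commutativeSemigroup using () renaming (interchange to +-interchange)
  open import Algebra.Properties.CommutativeSemigroup *-commutativeSemigroup using () renaming (interchange to *-interchange)
  open import Algebra.Properties.Group +-group using (⁻¹-involutive; ε⁻¹≈ε)
  open import Algebra.Properties.Semiring.Mult semiring using (×-homo-+; ×1-homo-*)
    renaming (_×_ to _·_)
  open IsTotalOrder isTotalOrder using (antisym; total; reflexive) renaming (trans to ≤-trans; refl to ≤-refl)

  ιℕ : ℕ → Carrier
  ιℕ n = n · 1ᴿ

  ιℕ-+ : ∀ m n → ιℕ (m ℕ.+ n) ≡ ιℕ m + ιℕ n
  ιℕ-+ = ×-homo-+ 1ᴿ

  ιℤ : ℤ → Carrier
  ιℤ (pos n)  = ιℕ n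
  ιℤ -[1+ n ] = -ᴿ ιℕ (suc n)

  private
    -‿involutive : ∀ x → -ᴿ (-ᴿ x) ≡ x
    -‿involutive = ⁻¹-involutive

    -0≡0 : -ᴿ 0ᴿ ≡ 0ᴿ
    -0≡0 = ε⁻¹≈ε

    -x*-y≡x*y : ∀ x y → (-ᴿ x) * (-ᴿ y) ≡ x * y
    -x*-y≡x*y x y = begin
      (-ᴿ x) * (-ᴿ y)  ≡⟨ sym (-‿distribˡ-* x (-ᴿ y)) ⟩
      -ᴿ (x * (-ᴿ y))  ≡⟨ cong -ᴿ_ (sym (-‿distribʳ-* x y)) ⟩
      -ᴿ (-ᴿ (x * y))  ≡⟨ -‿involutive _ ⟩
      x * y            ∎
      where open ≡-Reasoning

    1+x-[1+y]≡x-y : ∀ x y → (1ᴿ + x) - (1ᴿ + y) ≡ x - y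
    1+x-[1+y]≡x-y x y = begin
      (1ᴿ + x) + -ᴿ (1ᴿ + y)          ≡⟨ cong ((1ᴿ + x) +_) (sym (⁻¹-∙-comm 1ᴿ y)) ⟩
      (1ᴿ + x) + ((-ᴿ 1ᴿ) + (-ᴿ y))   ≡⟨ +-interchange 1ᴿ x _ _ ⟩
      (1ᴿ - 1ᴿ) + (x - y)             ≡⟨ cong (_+ (x - y)) (-‿inverseʳ 1ᴿ) ⟩
      0ᴿ + (x - y)                    ≡⟨ +-identityˡ _ ⟩
      x - y                           ∎
      where open ≡-Reasoning

    ιℤ-⊖ : ∀ m n → ιℤ (m ⊖ n) ≡ ιℕ m - ιℕ n
    ιℤ-⊖ m       zero    = sym (trans (cong (ιℕ m +_) -0≡0) (+-identityʳ _))
    ιℤ-⊖ zero    (suc n) = sym (+-identityˡ _)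
    ιℤ-⊖ (suc m) (suc n) rewrite ℤP.[1+m]⊖[1+n]≡m⊖n m n | ιℤ-⊖ m n = sym (1+x-[1+y]≡x-y _ _)

  ιℤ-neg : ∀ i → ιℤ (ℤ.- i) ≡ -ᴿ ιℤ i
  ιℤ-neg (pos zero)    = sym -0≡0
  ιℤ-neg (pos (suc n)) = refl
  ιℤ-neg -[1+ n ]      = sym (-‿involutive _)

  ιℤ-+ : ∀ i j → ιℤ (i ℤ.+ j) ≡ ιℤ i + ιℤ j
  ιℤ-+ (pos m)  (pos n)  = ιℕ-+ m n
  ιℤ-+ (pos m)  -[1+ n ] = ιℤ-⊖ m (suc n)
  ιℤ-+ -[1+ m ] (pos n)  = trans (ιℤ-⊖ n (suc m)) (+-comm _ _)
  ιℤ-+ -[1+ m ] -[1+ n ] = begin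
    -ᴿ ιℕ (suc (suc (m ℕ.+ n)))        ≡⟨ cong (λ k → -ᴿ ιℕ (suc k)) (sym (ℕP.+-suc m n)) ⟩
    -ᴿ ιℕ (suc m ℕ.+ suc n)            ≡⟨ cong -ᴿ_ (ιℕ-+ (suc m) (suc n)) ⟩
    -ᴿ (ιℕ (suc m) + ιℕ (suc n))        ≡⟨ sym (⁻¹-∙-comm _ _) ⟩
    (-ᴿ ιℕ (suc m)) + (-ᴿ ιℕ (suc n))   ∎
    where open ≡-Reasoning

  private
    σ : Sign → Carrier
    σ Sign.+ = 1ᴿ
    σ Sign.- = -ᴿ 1ᴿ

    σ-* : ∀ s t → σ (s Sign.* t) ≡ σ s * σ t
    σ-* Sign.+ t      = sym (*-identityˡ _)
    σ-* Sign.- Sign.+ = sym (*-identityʳ _)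
    σ-* Sign.- Sign.- = trans (sym (*-identityˡ 1ᴿ)) (sym (-x*-y≡x*y 1ᴿ 1ᴿ))

    ιℤ-◃ : ∀ s n → ιℤ (s ◃ n) ≡ σ s * ιℕ n
    ιℤ-◃ Sign.+ n rewrite ℤP.+◃n≡+n n = sym (*-identityˡ _)
    ιℤ-◃ Sign.- n rewrite ℤP.-◃n≡-n n = trans (ιℤ-neg (pos n)) (sym (-1*x≈-x _))

    ιℤ-sign-abs : ∀ i → ιℤ i ≡ σ (sign i) * ιℕ ∣ i ∣
    ιℤ-sign-abs i = trans (cong ιℤ (sym (ℤP.◃-inverse i))) (ιℤ-◃ (sign i) ∣ i ∣)

  ιℤ-* : ∀ i j → ιℤ (i ℤ.* j) ≡ ιℤ i * ιℤ j
  ιℤ-* i j = begin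
    ιℤ ((sign i Sign.* sign j) ◃ (∣ i ∣ ℕ.* ∣ j ∣))          ≡⟨ ιℤ-◃ (sign i Sign.* sign j) (∣ i ∣ ℕ.* ∣ j ∣) ⟩
    σ (sign i Sign.* sign j) * ιℕ (∣ i ∣ ℕ.* ∣ j ∣)          ≡⟨ cong₂ _*_ (σ-* (sign i) (sign j)) (×1-homo-* ∣ i ∣ ∣ j ∣) ⟩
    (σ (sign i) * σ (sign j)) * (ιℕ ∣ i ∣ * ιℕ ∣ j ∣)         ≡⟨ *-interchange _ _ _ _ ⟩
    (σ (sign i) * ιℕ ∣ i ∣) * (σ (sign j) * ιℕ ∣ j ∣)         ≡⟨ sym (cong₂ _*_ (ιℤ-sign-abs i) (ιℤ-sign-abs j)) ⟩
    ιℤ i * ιℤ j                                            ∎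
    where open ≡-Reasoning

  ιℤ-- : ∀ i j → ιℤ (i ℤ.- j) ≡ ιℤ i - ιℤ j
  ιℤ-- i j = trans (ιℤ-+ i (ℤ.- j)) (cong (ιℤ i +_) (ιℤ-neg j))

  private
    ιℤ-homomorphism : ACR._-Raw-AlmostCommutative⟶_
                        (ACR.AlmostCommutativeRing.rawRing (ACR.fromCommutativeRing ℤP.+-*-commutativeRing))
                        (ACR.fromCommutativeRing commutativeRing)
    ιℤ-homomorphism = record
      { ⟦_⟧ = ιℤ ; +-homo = ιℤ-+ ; *-homo = ιℤ-* ; -‿homo = ιℤ-neg ; 0-homo = refl ; 1-homo = +-identityʳ 1ᴿ }

    ιℤ-≟ : ∀ i j → Maybe (ιℤ i ≡ ιℤ j)
    ιℤ-≟ i j with i ℤP.≟ j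
    ... | yes refl = just refl
    ... | no _     = nothing

  -- The solver reads integer constants through ιℤ, so con (pos 1) is 1ᴿ + 0ᴿ, not 1ᴿ.
  open Algebra.Solver.Ring _ _ ιℤ-homomorphism ιℤ-≟ public
    using (solve; _:+_; _:*_; _:-_; :-_; _:=_; con)

  ≤-poset : Poset 0ℓ 0ℓ 0ℓ
  ≤-poset = record { isPartialOrder = IsTotalOrder.isPartialOrder isTotalOrder }

  module ≤-Reasoning = Relation.Binary.Reasoning.PartialOrder ≤-poset

  +-monoˡ-≤ : ∀ {x y} z → x ≤ y → z + x ≤ z + y
  +-monoˡ-≤ {x} {y} z x≤y rewrite +-comm z x | +-comm z y = +-mono z x≤y

  private
    x+z-z≡x : ∀ x z → x + z - z ≡ x
    x+z-z≡x x z = solve 2 (λ x z → x :+ z :- z := x) refl x z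

  +-cancelʳ-≤ : ∀ {x y} z → x + z ≤ y + z → x ≤ y
  +-cancelʳ-≤ {x} {y} z x+z≤y+z = subst₂ _≤_ (x+z-z≡x x z) (x+z-z≡x y z) (+-mono (-ᴿ z) x+z≤y+z)

  +-cancelˡ-≤ : ∀ {x y} z → z + x ≤ z + y → x ≤ y
  +-cancelˡ-≤ {x} {y} z z+x≤z+y rewrite +-comm z x | +-comm z y = +-cancelʳ-≤ z z+x≤z+y

  x≤y⇒0≤y-x : ∀ {x y} → x ≤ y → 0ᴿ ≤ y - x
  x≤y⇒0≤y-x {x} {y} x≤y = subst (_≤ y - x) (-‿inverseʳ x) (+-mono (-ᴿ x) x≤y)

  0≤y-x⇒x≤y : ∀ {x y} → 0ᴿ ≤ y - x → x ≤ y
  0≤y-x⇒x≤y {x} {y} 0≤y-x =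
    subst₂ _≤_ (+-identityˡ x) (solve 2 (λ x y → y :- x :+ x := y) refl x y) (+-mono x 0≤y-x)

  x≤x+y : ∀ {x} y → 0ᴿ ≤ y → x ≤ x + y
  x≤x+y {x} y 0≤y = subst (_≤ x + y) (+-identityʳ x) (+-monoˡ-≤ x 0≤y)

  +-nonneg : ∀ {x y} → 0ᴿ ≤ x → 0ᴿ ≤ y → 0ᴿ ≤ x + y
  +-nonneg {x} {y} 0≤x 0≤y = ≤-trans 0≤x (x≤x+y y 0≤y)

  *-monoʳ-≤ : ∀ {x y} z → 0ᴿ ≤ z → x ≤ y → x * z ≤ y * z
  *-monoʳ-≤ {x} {y} z 0≤z x≤y = 0≤y-x⇒x≤y (subst (0ᴿ ≤_)
    (solve 3 (λ x y z → (y :- x) :* z := y :* z :- x :* z) refl x y z)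
    (*-nonneg (x≤y⇒0≤y-x x≤y) 0≤z))

  *-monoˡ-≤ : ∀ {x y} z → 0ᴿ ≤ z → x ≤ y → z * x ≤ z * y
  *-monoˡ-≤ {x} {y} z 0≤z x≤y rewrite *-comm z x | *-comm z y = *-monoʳ-≤ z 0≤z x≤y

  *-mono-≤ : ∀ {x y u v} → 0ᴿ ≤ x → 0ᴿ ≤ v → x ≤ y → u ≤ v → x * u ≤ y * v
  *-mono-≤ {x} {y} {u} {v} 0≤x 0≤v x≤y u≤v = ≤-trans (*-monoˡ-≤ x 0≤x u≤v) (*-monoʳ-≤ v 0≤v x≤y)

  private
    x≤0⇒0≤-x : ∀ {x} → x ≤ 0ᴿ → 0ᴿ ≤ -ᴿ x
    x≤0⇒0≤-x {x} x≤0 = subst₂ _≤_ (-‿inverseʳ x) (+-identityˡ _) (+-mono (-ᴿ x) x≤0)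

  0≤x*x : ∀ x → 0ᴿ ≤ x * x
  0≤x*x x with total 0ᴿ x
  ... | inj₁ 0≤x = *-nonneg 0≤x 0≤x
  ... | inj₂ x≤0 = subst (0ᴿ ≤_) (-x*-y≡x*y x x) (*-nonneg (x≤0⇒0≤-x x≤0) (x≤0⇒0≤-x x≤0))

  0≤1 : 0ᴿ ≤ 1ᴿ
  0≤1 = subst (0ᴿ ≤_) (*-identityˡ 1ᴿ) (0≤x*x 1ᴿ)

  1≰0 : ¬ (1ᴿ ≤ 0ᴿ)
  1≰0 1≤0 = 0≢1 (antisym 0≤1 1≤0)

  1≤x⇒x≢0 : ∀ {x} → 1ᴿ ≤ x → x ≢ 0ᴿ
  1≤x⇒x≢0 1≤x refl = 1≰0 1≤x

  1+x≰x : ∀ {x} → ¬ (1ᴿ + x ≤ x)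
  1+x≰x {x} 1+x≤x = 1≰0 (+-cancelʳ-≤ x (subst (1ᴿ + x ≤_) (sym (+-identityˡ x)) 1+x≤x))

  0≤ιℕ : ∀ n → 0ᴿ ≤ ιℕ n
  0≤ιℕ zero    = ≤-refl
  0≤ιℕ (suc n) = +-nonneg 0≤1 (0≤ιℕ n)

  1≤ιℕ-suc : ∀ n → 1ᴿ ≤ ιℕ (suc n)
  1≤ιℕ-suc n = x≤x+y (ιℕ n) (0≤ιℕ n)

  ιℕ-injective : ∀ {m n} → ιℕ m ≡ ιℕ n → m ≡ n
  ιℕ-injective {zero}  {zero}  _  = refl
  ιℕ-injective {zero}  {suc n} eq = ⊥-elim (1≤x⇒x≢0 (1≤ιℕ-suc n) (sym eq))
  ιℕ-injective {suc m} {zero}  eq = ⊥-elim (1≤x⇒x≢0 (1≤ιℕ-suc m) eq)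
  ιℕ-injective {suc m} {suc n} eq =
    cong suc (ιℕ-injective (trans (sym (1+x-1≡x (ιℕ m))) (trans (cong (_- 1ᴿ) eq) (1+x-1≡x (ιℕ n)))))
    where
    1+x-1≡x : ∀ x → 1ᴿ + x - 1ᴿ ≡ x
    1+x-1≡x x = trans (cong (_- 1ᴿ) (+-comm 1ᴿ x)) (x+z-z≡x x 1ᴿ)

  private
    ιℤ≡0⇒≡0 : ∀ i → ιℤ i ≡ 0ᴿ → i ≡ pos 0
    ιℤ≡0⇒≡0 (pos n)    eq = cong pos (ιℕ-injective eq)
    ιℤ≡0⇒≡0 -[1+ n ]   eq =
      ⊥-elim (1≤x⇒x≢0 (1≤ιℕ-suc n) (trans (sym (-‿involutive _)) (trans (cong -ᴿ_ eq) -0≡0)))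

  ιℤ-injective : ∀ i j → ιℤ i ≡ ιℤ j → i ≡ j
  ιℤ-injective i j eq =
    ℤP.i-j≡0⇒i≡j i j (ιℤ≡0⇒≡0 _ (trans (ιℤ-- i j) (trans (cong (_- ιℤ j) eq) (-‿inverseʳ _))))

  _⁻¹⟨_⟩ : (x : Carrier) → x ≢ 0ᴿ → Carrier
  x ⁻¹⟨ x≢0 ⟩ = proj₁ (inverse x x≢0)

  x*x⁻¹≡1 : ∀ x (x≢0 : x ≢ 0ᴿ) → x * x ⁻¹⟨ x≢0 ⟩ ≡ 1ᴿ
  x*x⁻¹≡1 x x≢0 = proj₂ (inverse x x≢0)

  0≤x⁻¹ : ∀ {x} (x≢0 : x ≢ 0ᴿ) → 0ᴿ ≤ x → 0ᴿ ≤ x ⁻¹⟨ x≢0 ⟩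
  0≤x⁻¹ {x} x≢0 0≤x with total 0ᴿ (x ⁻¹⟨ x≢0 ⟩)
  ... | inj₁ 0≤x⁻¹ = 0≤x⁻¹
  ... | inj₂ x⁻¹≤0 = ⊥-elim (1≰0 (subst₂ _≤_ (x*x⁻¹≡1 x x≢0) (zeroʳ x) (*-monoˡ-≤ x 0≤x x⁻¹≤0)))

  x*y≡0⇒x≡0 : ∀ {x y} → y ≢ 0ᴿ → x * y ≡ 0ᴿ → x ≡ 0ᴿ
  x*y≡0⇒x≡0 {x} {y} y≢0 xy≡0 = begin
    x                        ≡⟨ sym (*-identityʳ x) ⟩
    x * 1ᴿ                   ≡⟨ cong (x *_) (sym (x*x⁻¹≡1 y y≢0)) ⟩
    x * (y * y ⁻¹⟨ y≢0 ⟩)     ≡⟨ sym (*-assoc x y _) ⟩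
    (x * y) * y ⁻¹⟨ y≢0 ⟩     ≡⟨ cong (_* y ⁻¹⟨ y≢0 ⟩) xy≡0 ⟩
    0ᴿ * y ⁻¹⟨ y≢0 ⟩          ≡⟨ zeroˡ _ ⟩
    0ᴿ                       ∎
    where open ≡-Reasoning

  x-y≡0⇒x≡y : ∀ {x y} → x - y ≡ 0ᴿ → x ≡ y
  x-y≡0⇒x≡y {x} {y} x-y≡0 = begin
    x              ≡⟨ solve 2 (λ x y → x := (x :- y) :+ y) refl x y ⟩
    (x - y) + y    ≡⟨ cong (_+ y) x-y≡0 ⟩
    0ᴿ + y         ≡⟨ +-identityˡ y ⟩
    y              ∎
    where open ≡-Reasoning

  +-cancelʳ-≡ : ∀ {x y} z → x + z ≡ y + z → x ≡ y
  +-cancelʳ-≡ {x} {y} z eq = trans (sym (x+z-z≡x x z)) (trans (cong (_- z) eq) (x+z-z≡x y z))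

  *-cancelʳ-≡ : ∀ {x y} z → z ≢ 0ᴿ → x * z ≡ y * z → x ≡ y
  *-cancelʳ-≡ {x} {y} z z≢0 eq = x-y≡0⇒x≡y (x*y≡0⇒x≡0 z≢0 (begin
    (x - y) * z      ≡⟨ solve 3 (λ x y z → (x :- y) :* z := x :* z :- y :* z) refl x y z ⟩
    x * z - y * z    ≡⟨ cong (_- y * z) eq ⟩
    y * z - y * z    ≡⟨ -‿inverseʳ _ ⟩
    0ᴿ               ∎))
    where open ≡-Reasoning

  *-cancelʳ-≤ : ∀ {x y} z → 0ᴿ ≤ z → z ≢ 0ᴿ → x * z ≤ y * z → x ≤ y
  *-cancelʳ-≤ {x} {y} z 0≤z z≢0 xz≤yz with total x y
  ... | inj₁ x≤y = x≤y
  ... | inj₂ y≤x = reflexive (*-cancelʳ-≡ z z≢0 (antisym xz≤yz (*-monoʳ-≤ z 0≤z y≤x)))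

  x*x≡y*y⇒x≡y : ∀ {x y} → 0ᴿ ≤ x → 0ᴿ ≤ y → y ≢ 0ᴿ → x * x ≡ y * y → x ≡ y
  x*x≡y*y⇒x≡y {x} {y} 0≤x 0≤y y≢0 xx≡yy = x-y≡0⇒x≡y (x*y≡0⇒x≡0 x+y≢0 (begin
    (x - y) * (x + y)  ≡⟨ solve 2 (λ x y → (x :- y) :* (x :+ y) := x :* x :- y :* y) refl x y ⟩
    x * x - y * y      ≡⟨ cong (_- y * y) xx≡yy ⟩
    y * y - y * y      ≡⟨ -‿inverseʳ _ ⟩
    0ᴿ                 ∎))
    where
    open ≡-Reasoning
    x+y≢0 : x + y ≢ 0ᴿ
    x+y≢0 x+y≡0 = y≢0 (antisym (subst (y ≤_) (trans (+-comm y x) x+y≡0) (x≤x+y x 0≤x)) 0≤y)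

  -- For the supremum s of {y ∣ y² ≤ c}: the Newton iterate (s² + c)/2s is
  -- an upper bound of the set, so s² ≤ c; and 2cs/(s² + c) lies in the set,
  -- so c ≤ s².
  private
    module Square-root (c : Carrier) (1≤c : 1ᴿ ≤ c) where
      Below : Carrier → Set
      Below y = y * y ≤ c

      0≤c : 0ᴿ ≤ c
      0≤c = ≤-trans 0≤1 1≤c

      below-1 : Below 1ᴿ
      below-1 = subst (_≤ c) (sym (*-identityˡ 1ᴿ)) 1≤c

      below-bounded : ∀ y → Below y → y ≤ 1ᴿ + c
      below-bounded y y²≤c with total y (1ᴿ + c)
      ... | inj₁ y≤1+c = y≤1+c
      ... | inj₂ 1+c≤y = ⊥-elim (1+x≰x (begin
        1ᴿ + c                ≡⟨ sym (*-identityˡ _) ⟩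
        1ᴿ * (1ᴿ + c)          ≤⟨ *-monoʳ-≤ (1ᴿ + c) 0≤1+c (x≤x+y c 0≤c) ⟩
        (1ᴿ + c) * (1ᴿ + c)    ≤⟨ *-mono-≤ 0≤1+c (≤-trans 0≤1+c 1+c≤y) 1+c≤y 1+c≤y ⟩
        y * y                 ≤⟨ y²≤c ⟩
        c                     ∎))
        where
        open ≤-Reasoning
        0≤1+c : 0ᴿ ≤ 1ᴿ + c
        0≤1+c = +-nonneg 0≤1 0≤c

      supremum : Σ Carrier λ s → (∀ y → Below y → y ≤ s) × (∀ b → (∀ y → Below y → y ≤ b) → s ≤ b)
      supremum = sup Below (1ᴿ , below-1) (1ᴿ + c , below-bounded)

      s : Carrier
      s = proj₁ supremum

      s-upper : ∀ y → Below y → y ≤ s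
      s-upper = proj₁ (proj₂ supremum)

      s-least : ∀ b → (∀ y → Below y → y ≤ b) → s ≤ b
      s-least = proj₂ (proj₂ supremum)

      1≤s : 1ᴿ ≤ s
      1≤s = s-upper 1ᴿ below-1

      0≤s : 0ᴿ ≤ s
      0≤s = ≤-trans 0≤1 1≤s

      1≤s²+c : 1ᴿ ≤ s * s + c
      1≤s²+c = ≤-trans 1≤c (subst (c ≤_) (+-comm c (s * s)) (x≤x+y (s * s) (0≤x*x s)))

      2s : Carrier
      2s = s + s

      0≤2s : 0ᴿ ≤ 2s
      0≤2s = +-nonneg 0≤s 0≤s

      2s≢0 : 2s ≢ 0ᴿ
      2s≢0 = 1≤x⇒x≢0 (≤-trans 1≤s (x≤x+y s 0≤s))

      newton : Carrier
      newton = (s * s + c) * 2s ⁻¹⟨ 2s≢0 ⟩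

      newton*2s≡s²+c : newton * 2s ≡ s * s + c
      newton*2s≡s²+c = begin
        (s * s + c) * 2s ⁻¹⟨ 2s≢0 ⟩ * 2s    ≡⟨ *-assoc _ _ 2s ⟩
        (s * s + c) * (2s ⁻¹⟨ 2s≢0 ⟩ * 2s)  ≡⟨ cong ((s * s + c) *_) (trans (*-comm _ 2s) (x*x⁻¹≡1 2s 2s≢0)) ⟩
        (s * s + c) * 1ᴿ                  ≡⟨ *-identityʳ _ ⟩
        s * s + c                         ∎
        where open ≡-Reasoning

      c≤newton² : c ≤ newton * newton
      c≤newton² = subst (c ≤_) (sym newton²≡c+e²) (x≤x+y (e * e) (0≤x*x e))
        where
        open ≡-Reasoning
        i e : Carrier
        i = 2s ⁻¹⟨ 2s≢0 ⟩
        e = (s * s - c) * i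
        newton²≡c+e² : newton * newton ≡ c + e * e
        newton²≡c+e² = begin
          newton * newton                    ≡⟨ solve 3 (λ s c i →
                                                  ((s :* s :+ c) :* i) :* ((s :* s :+ c) :* i)
                                                  := c :* (((s :+ s) :* i) :* ((s :+ s) :* i))
                                                     :+ ((s :* s :- c) :* i) :* ((s :* s :- c) :* i)) refl s c i ⟩
          c * ((2s * i) * (2s * i)) + e * e   ≡⟨ cong (λ z → c * (z * z) + e * e) (x*x⁻¹≡1 2s 2s≢0) ⟩
          c * (1ᴿ * 1ᴿ) + e * e               ≡⟨ cong (λ z → c * z + e * e) (*-identityˡ 1ᴿ) ⟩
          c * 1ᴿ + e * e                     ≡⟨ cong (_+ e * e) (*-identityʳ c) ⟩
          c + e * e                          ∎

      newton-upper : ∀ y → Below y → y ≤ newton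
      newton-upper y y²≤c with total y newton
      ... | inj₁ y≤newton = y≤newton
      ... | inj₂ newton≤y = reflexive (x*x≡y*y⇒x≡y 0≤y 0≤newton newton≢0
              (antisym (≤-trans y²≤c c≤newton²) (*-mono-≤ 0≤newton 0≤y newton≤y newton≤y)))
        where
        0≤newton : 0ᴿ ≤ newton
        0≤newton = *-nonneg (≤-trans 0≤1 1≤s²+c) (0≤x⁻¹ 2s≢0 0≤2s)
        newton≢0 : newton ≢ 0ᴿ
        newton≢0 newton≡0 = 1≤x⇒x≢0 1≤s²+c (trans (sym newton*2s≡s²+c) (trans (cong (_* 2s) newton≡0) (zeroˡ 2s)))
        0≤y : 0ᴿ ≤ y
        0≤y = ≤-trans 0≤newton newton≤y

      s²≤c : s * s ≤ c
      s²≤c = +-cancelˡ-≤ (s * s) (subst₂ _≤_ s*2s≡s²+s² newton*2s≡s²+c (*-monoʳ-≤ 2s 0≤2s (s-least newton newton-upper)))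
        where
        s*2s≡s²+s² : s * 2s ≡ s * s + s * s
        s*2s≡s²+s² = solve 1 (λ s → s :* (s :+ s) := s :* s :+ s :* s) refl s

      s²+c≢0 : s * s + c ≢ 0ᴿ
      s²+c≢0 = 1≤x⇒x≢0 1≤s²+c

      y₀ : Carrier
      y₀ = ((c + c) * s) * (s * s + c) ⁻¹⟨ s²+c≢0 ⟩

      below-y₀ : Below y₀
      below-y₀ = subst (y₀ * y₀ ≤_) y₀²+ce²≡c (x≤x+y _ (*-nonneg 0≤c (0≤x*x e)))
        where
        open ≡-Reasoning
        j e : Carrier
        j = (s * s + c) ⁻¹⟨ s²+c≢0 ⟩
        e = (s * s - c) * j
        y₀²+ce²≡c : y₀ * y₀ + c * (e * e) ≡ c
        y₀²+ce²≡c = begin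
          y₀ * y₀ + c * (e * e)                         ≡⟨ solve 3 (λ s c j →
                                                             ((c :+ c) :* s :* j) :* ((c :+ c) :* s :* j)
                                                             :+ c :* (((s :* s :- c) :* j) :* ((s :* s :- c) :* j))
                                                             := c :* (((s :* s :+ c) :* j) :* ((s :* s :+ c) :* j)))
                                                             refl s c j ⟩
          c * (((s * s + c) * j) * ((s * s + c) * j))   ≡⟨ cong (λ z → c * (z * z)) (x*x⁻¹≡1 _ s²+c≢0) ⟩
          c * (1ᴿ * 1ᴿ)                                 ≡⟨ cong (c *_) (*-identityˡ 1ᴿ) ⟩
          c * 1ᴿ                                        ≡⟨ *-identityʳ c ⟩
          c                                            ∎

      c≤s² : c ≤ s * s
      c≤s² = *-cancelʳ-≤ s 0≤s (1≤x⇒x≢0 1≤s)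
               (+-cancelʳ-≤ (c * s) (subst₂ _≤_ y₀[s²+c]≡cs+cs s[s²+c]≡s²s+cs
                 (*-monoʳ-≤ (s * s + c) (≤-trans 0≤1 1≤s²+c) (s-upper y₀ below-y₀))))
        where
        open ≡-Reasoning
        y₀[s²+c]≡cs+cs : y₀ * (s * s + c) ≡ c * s + c * s
        y₀[s²+c]≡cs+cs = begin
          ((c + c) * s) * (s * s + c) ⁻¹⟨ s²+c≢0 ⟩ * (s * s + c)
            ≡⟨ *-assoc _ _ _ ⟩
          ((c + c) * s) * ((s * s + c) ⁻¹⟨ s²+c≢0 ⟩ * (s * s + c))
            ≡⟨ cong (((c + c) * s) *_) (trans (*-comm _ _) (x*x⁻¹≡1 _ s²+c≢0)) ⟩
          ((c + c) * s) * 1ᴿ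
            ≡⟨ *-identityʳ _ ⟩
          (c + c) * s
            ≡⟨ solve 2 (λ c s → (c :+ c) :* s := c :* s :+ c :* s) refl c s ⟩
          c * s + c * s ∎

        s[s²+c]≡s²s+cs : s * (s * s + c) ≡ (s * s) * s + c * s
        s[s²+c]≡s²s+cs = solve 2 (λ s c → s :* (s :* s :+ c) := (s :* s) :* s :+ c :* s) refl s c

  √-exists : ∀ c → 1ᴿ ≤ c → Σ Carrier λ s → 1ᴿ ≤ s × s * s ≡ c
  √-exists c 1≤c = s , 1≤s , antisym s²≤c c≤s²
    where open Square-root c 1≤c

module Plane (ℝ : CompleteOrderedField) where
  open import Data.Integer as ℤ using (ℤ) renaming (+_ to pos)

  open OrderedField ℝ
  open Lattice using (dist²; norm; Cell; _⊕_)

  Point : Set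
  Point = Carrier × Carrier

  infixl 6 _+ᵥ_ _-ᵥ_
  _+ᵥ_ _-ᵥ_ : Point → Point → Point
  (x₁ , x₂) +ᵥ (y₁ , y₂) = (x₁ + y₁ , x₂ + y₂)
  (x₁ , x₂) -ᵥ (y₁ , y₂) = (x₁ - y₁ , x₂ - y₂)

  infix 8 _·_
  _·_ : Point → Point → Carrier
  (x₁ , x₂) · (y₁ , y₂) = x₁ * y₁ + x₂ * y₂

  private
    2≢0 : ιℕ 2 ≢ 0ᴿ
    2≢0 = 1≤x⇒x≢0 (1≤ιℕ-suc 1)

    x*2≡0⇒x≡0 : ∀ {x} → x * ιℕ 2 ≡ 0ᴿ → x ≡ 0ᴿ
    x*2≡0⇒x≡0 = x*y≡0⇒x≡0 2≢0

    0+0≡0 : ∀ {x y} → x ≡ 0ᴿ → y ≡ 0ᴿ → x + y ≡ 0ᴿ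
    0+0≡0 refl refl = +-identityˡ 0ᴿ

    same⇒x-y≡0 : ∀ {x y z} → x ≡ z → y ≡ z → x - y ≡ 0ᴿ
    same⇒x-y≡0 refl refl = -‿inverseʳ _

  cross : Point → Point → Carrier
  cross (d₁ , d₂) (v₁ , v₂) = d₁ * v₂ - d₂ * v₁

  orthogonal-to-unit : ∀ d v → d · d ≡ 1ᴿ → v · d ≡ 0ᴿ →
                       v ≡ (-ᴿ (cross d v * proj₂ d) , cross d v * proj₁ d)
  orthogonal-to-unit (d₁ , d₂) (v₁ , v₂) d·d≡1 v·d≡0 = cong₂ _,_
    (begin
      v₁                                             ≡⟨ ×unit v₁ ⟩
      v₁ * (d₁ * d₁ + d₂ * d₂)                        ≡⟨ solve 4 (λ v₁ v₂ d₁ d₂ →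
                                                          v₁ :* (d₁ :* d₁ :+ d₂ :* d₂)
                                                          := (v₁ :* d₁ :+ v₂ :* d₂) :* d₁ :- (d₁ :* v₂ :- d₂ :* v₁) :* d₂)
                                                          refl v₁ v₂ d₁ d₂ ⟩
      (v₁ * d₁ + v₂ * d₂) * d₁ - λᵥ * d₂               ≡⟨ cong (λ t → t * d₁ - λᵥ * d₂) v·d≡0 ⟩
      0ᴿ * d₁ - λᵥ * d₂                                ≡⟨ solve 3 (λ d₁ d₂ c → con (pos 0) :* d₁ :- c :* d₂ := :- (c :* d₂))
                                                          refl d₁ d₂ λᵥ ⟩
      -ᴿ (λᵥ * d₂)                                    ∎)
    (begin
      v₂                                             ≡⟨ ×unit v₂ ⟩
      v₂ * (d₁ * d₁ + d₂ * d₂)                        ≡⟨ solve 4 (λ v₁ v₂ d₁ d₂ →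
                                                          v₂ :* (d₁ :* d₁ :+ d₂ :* d₂)
                                                          := (v₁ :* d₁ :+ v₂ :* d₂) :* d₂ :+ (d₁ :* v₂ :- d₂ :* v₁) :* d₁)
                                                          refl v₁ v₂ d₁ d₂ ⟩
      (v₁ * d₁ + v₂ * d₂) * d₂ + λᵥ * d₁               ≡⟨ cong (λ t → t * d₂ + λᵥ * d₁) v·d≡0 ⟩
      0ᴿ * d₂ + λᵥ * d₁                                ≡⟨ solve 3 (λ d₁ d₂ c → con (pos 0) :* d₂ :+ c :* d₁ := c :* d₁)
                                                          refl d₁ d₂ λᵥ ⟩
      λᵥ * d₁                                         ∎)
    where
    open ≡-Reasoning
    λᵥ : Carrier
    λᵥ = cross (d₁ , d₂) (v₁ , v₂)
    ×unit : ∀ x → x ≡ x * (d₁ * d₁ + d₂ * d₂)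
    ×unit x = sym (trans (cong (x *_) d·d≡1) (*-identityʳ x))

  orthogonal-product : ∀ d u v → d · d ≡ 1ᴿ → u · d ≡ 0ᴿ → v · d ≡ 0ᴿ → u · v ≡ cross d u * cross d v
  orthogonal-product d@(d₁ , d₂) u v d·d≡1 u·d≡0 v·d≡0 = begin
    u · v                                                   ≡⟨ cong₂ _·_ (orthogonal-to-unit d u d·d≡1 u·d≡0)
                                                                         (orthogonal-to-unit d v d·d≡1 v·d≡0) ⟩
    (-ᴿ (λᵤ * d₂) , λᵤ * d₁) · (-ᴿ (λᵥ * d₂) , λᵥ * d₁)        ≡⟨ solve 4 (λ λᵤ λᵥ d₁ d₂ →
                                                                 (:- (λᵤ :* d₂)) :* (:- (λᵥ :* d₂)) :+ (λᵤ :* d₁) :* (λᵥ :* d₁)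
                                                                 := λᵤ :* λᵥ :* (d₁ :* d₁ :+ d₂ :* d₂)) refl λᵤ λᵥ d₁ d₂ ⟩
    λᵤ * λᵥ * (d · d)                                       ≡⟨ cong (λᵤ * λᵥ *_) d·d≡1 ⟩
    λᵤ * λᵥ * 1ᴿ                                            ≡⟨ *-identityʳ _ ⟩
    λᵤ * λᵥ                                                 ∎
    where
    open ≡-Reasoning
    λᵤ λᵥ : Carrier
    λᵤ = cross d u
    λᵥ = cross d v

  orthogonal-cross≡0 : ∀ d v → d · d ≡ 1ᴿ → v · d ≡ 0ᴿ → cross d v ≡ 0ᴿ → v ≡ (0ᴿ , 0ᴿ)
  orthogonal-cross≡0 d@(d₁ , d₂) v d·d≡1 v·d≡0 λ≡0 = begin
    v                                            ≡⟨ orthogonal-to-unit d v d·d≡1 v·d≡0 ⟩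
    (-ᴿ (cross d v * d₂) , cross d v * d₁)        ≡⟨ cong (λ t → (-ᴿ (t * d₂) , t * d₁)) λ≡0 ⟩
    (-ᴿ (0ᴿ * d₂) , 0ᴿ * d₁)                      ≡⟨ cong₂ _,_ (solve 1 (λ x → :- (con (pos 0) :* x) := con (pos 0)) refl d₂)
                                                               (zeroˡ d₁) ⟩
    (0ᴿ , 0ᴿ)                                    ∎
    where open ≡-Reasoning

  private
    -ᵥ≡0⇒≡ : ∀ {u v} → u -ᵥ v ≡ (0ᴿ , 0ᴿ) → u ≡ v
    -ᵥ≡0⇒≡ eq = cong₂ _,_ (x-y≡0⇒x≡y (cong proj₁ eq)) (x-y≡0⇒x≡y (cong proj₂ eq))

    -- The three dot products below are, up to the factor 2, sums and
    -- differences of the squared side lengths of the rhombus.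
    module Rhombus (a b d : Point) (a·a≡1 : a · a ≡ 1ᴿ) (b·b≡1 : b · b ≡ 1ᴿ)
                   (∣a-d∣≡1 : (a -ᵥ d) · (a -ᵥ d) ≡ 1ᴿ) (∣b-d∣≡1 : (b -ᵥ d) · (b -ᵥ d) ≡ 1ᴿ) where
      open ≡-Reasoning

      E F : Point
      E = a -ᵥ b
      F = a +ᵥ b -ᵥ d

      Δa Δb : Carrier
      Δa = a · a - (a -ᵥ d) · (a -ᵥ d)
      Δb = b · b - (b -ᵥ d) · (b -ᵥ d)

      Δa≡0 : Δa ≡ 0ᴿ
      Δa≡0 = same⇒x-y≡0 a·a≡1 ∣a-d∣≡1

      Δb≡0 : Δb ≡ 0ᴿ
      Δb≡0 = same⇒x-y≡0 b·b≡1 ∣b-d∣≡1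

      E·d≡0 : E · d ≡ 0ᴿ
      E·d≡0 = x*2≡0⇒x≡0 (begin
        E · d * ιℕ 2  ≡⟨ solve 6 (λ a₁ a₂ b₁ b₂ d₁ d₂ →
                            ((a₁ :- b₁) :* d₁ :+ (a₂ :- b₂) :* d₂) :* con (pos 2)
                            := (a₁ :* a₁ :+ a₂ :* a₂ :- ((a₁ :- d₁) :* (a₁ :- d₁) :+ (a₂ :- d₂) :* (a₂ :- d₂)))
                               :- (b₁ :* b₁ :+ b₂ :* b₂ :- ((b₁ :- d₁) :* (b₁ :- d₁) :+ (b₂ :- d₂) :* (b₂ :- d₂))))
                            refl (proj₁ a) (proj₂ a) (proj₁ b) (proj₂ b) (proj₁ d) (proj₂ d) ⟩
        Δa - Δb       ≡⟨ same⇒x-y≡0 Δa≡0 Δb≡0 ⟩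
        0ᴿ            ∎)

      F·d≡0 : F · d ≡ 0ᴿ
      F·d≡0 = x*2≡0⇒x≡0 (begin
        F · d * ιℕ 2  ≡⟨ solve 6 (λ a₁ a₂ b₁ b₂ d₁ d₂ →
                            ((a₁ :+ b₁ :- d₁) :* d₁ :+ (a₂ :+ b₂ :- d₂) :* d₂) :* con (pos 2)
                            := (a₁ :* a₁ :+ a₂ :* a₂ :- ((a₁ :- d₁) :* (a₁ :- d₁) :+ (a₂ :- d₂) :* (a₂ :- d₂)))
                               :+ (b₁ :* b₁ :+ b₂ :* b₂ :- ((b₁ :- d₁) :* (b₁ :- d₁) :+ (b₂ :- d₂) :* (b₂ :- d₂))))
                            refl (proj₁ a) (proj₂ a) (proj₁ b) (proj₂ b) (proj₁ d) (proj₂ d) ⟩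
        Δa + Δb       ≡⟨ 0+0≡0 Δa≡0 Δb≡0 ⟩
        0ᴿ            ∎)

      E·F≡0 : E · F ≡ 0ᴿ
      E·F≡0 = x*2≡0⇒x≡0 (begin
        E · F * ιℕ 2  ≡⟨ solve 6 (λ a₁ a₂ b₁ b₂ d₁ d₂ →
                            ((a₁ :- b₁) :* (a₁ :+ b₁ :- d₁) :+ (a₂ :- b₂) :* (a₂ :+ b₂ :- d₂)) :* con (pos 2)
                            := (a₁ :* a₁ :+ a₂ :* a₂ :- (b₁ :* b₁ :+ b₂ :* b₂))
                               :+ ((a₁ :- d₁) :* (a₁ :- d₁) :+ (a₂ :- d₂) :* (a₂ :- d₂)
                                   :- ((b₁ :- d₁) :* (b₁ :- d₁) :+ (b₂ :- d₂) :* (b₂ :- d₂))))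
                            refl (proj₁ a) (proj₂ a) (proj₁ b) (proj₂ b) (proj₁ d) (proj₂ d) ⟩
        (a · a - b · b) + ((a -ᵥ d) · (a -ᵥ d) - (b -ᵥ d) · (b -ᵥ d))
                      ≡⟨ 0+0≡0 (same⇒x-y≡0 a·a≡1 b·b≡1) (same⇒x-y≡0 ∣a-d∣≡1 ∣b-d∣≡1) ⟩
        0ᴿ            ∎)

  -- a - b and a + b - d are both orthogonal to the unit vector d, hence
  -- parallel, and orthogonal to each other; as a ≠ b, a + b - d = 0.
  unit-rhombus : ∀ a b d → d · d ≡ 1ᴿ → a · a ≡ 1ᴿ → b · b ≡ 1ᴿ → (a -ᵥ d) · (a -ᵥ d) ≡ 1ᴿ → (b -ᵥ d) · (b -ᵥ d) ≡ 1ᴿ →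
                 a ≢ b → a +ᵥ b ≡ d
  unit-rhombus a b d d·d≡1 a·a≡1 b·b≡1 ∣a-d∣≡1 ∣b-d∣≡1 a≢b =
    -ᵥ≡0⇒≡ (orthogonal-cross≡0 d F d·d≡1 F·d≡0 (x*y≡0⇒x≡0 λ≢0 (begin
      cross d F * cross d E  ≡⟨ *-comm _ _ ⟩
      cross d E * cross d F  ≡⟨ sym (orthogonal-product d E F d·d≡1 E·d≡0 F·d≡0) ⟩
      E · F                  ≡⟨ E·F≡0 ⟩
      0ᴿ                     ∎)))
    where
    open ≡-Reasoning
    open Rhombus a b d a·a≡1 b·b≡1 ∣a-d∣≡1 ∣b-d∣≡1
    λ≢0 : cross d E ≢ 0ᴿ
    λ≢0 λ≡0 = a≢b (-ᵥ≡0⇒≡ (orthogonal-cross≡0 d E d·d≡1 E·d≡0 λ≡0))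

  private
    sqDist-via-base : ∀ y u v → sqDist ℝ u v ≡ (u -ᵥ y -ᵥ (v -ᵥ y)) · (u -ᵥ y -ᵥ (v -ᵥ y))
    sqDist-via-base (y₁ , y₂) (u₁ , u₂) (v₁ , v₂) = solve 6 (λ y₁ y₂ u₁ u₂ v₁ v₂ →
      (u₁ :- v₁) :* (u₁ :- v₁) :+ (u₂ :- v₂) :* (u₂ :- v₂)
      := (u₁ :- y₁ :- (v₁ :- y₁)) :* (u₁ :- y₁ :- (v₁ :- y₁)) :+ (u₂ :- y₂ :- (v₂ :- y₂)) :* (u₂ :- y₂ :- (v₂ :- y₂)))
      refl y₁ y₂ u₁ u₂ v₁ v₂

    sqDist-flip : ∀ u v → sqDist ℝ u v ≡ (v -ᵥ u) · (v -ᵥ u)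
    sqDist-flip (u₁ , u₂) (v₁ , v₂) = solve 4 (λ u₁ u₂ v₁ v₂ →
      (u₁ :- v₁) :* (u₁ :- v₁) :+ (u₂ :- v₂) :* (u₂ :- v₂) := (v₁ :- u₁) :* (v₁ :- u₁) :+ (v₂ :- u₂) :* (v₂ :- u₂))
      refl u₁ u₂ v₁ v₂

    fourth-vertex : ∀ x y z w → (x - y) + (w - y) ≡ z - y → x ≡ y + z - w
    fourth-vertex x y z w eq = x-y≡0⇒x≡y (trans
      (solve 4 (λ x y z w → x :- (y :+ z :- w) := (x :- y) :+ (w :- y) :- (z :- y)) refl x y z w) (same⇒x-y≡0 eq refl))

    -ᵥ-cancelʳ : ∀ {u v} y → u -ᵥ y ≡ v -ᵥ y → u ≡ v
    -ᵥ-cancelʳ {u₁ , u₂} {v₁ , v₂} (y₁ , y₂) eq = cong₂ _,_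
      (+-cancelʳ-≡ (-ᴿ y₁) (cong proj₁ eq)) (+-cancelʳ-≡ (-ᴿ y₂) (cong proj₂ eq))

  rhombus : ∀ x y z w →
            sqDist ℝ y z ≡ 1ᴿ → sqDist ℝ w y ≡ 1ᴿ → sqDist ℝ w z ≡ 1ᴿ → sqDist ℝ x y ≡ 1ᴿ → sqDist ℝ x z ≡ 1ᴿ →
            x ≢ w → x ≡ y +ᵥ z -ᵥ w
  rhombus x@(x₁ , x₂) y@(y₁ , y₂) z@(z₁ , z₂) w@(w₁ , w₂) yz wy wz xy xz x≢w =
    cong₂ _,_ (fourth-vertex x₁ y₁ z₁ w₁ (cong proj₁ a+b≡d)) (fourth-vertex x₂ y₂ z₂ w₂ (cong proj₂ a+b≡d))
    where
    a+b≡d : (x -ᵥ y) +ᵥ (w -ᵥ y) ≡ z -ᵥ y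
    a+b≡d = unit-rhombus (x -ᵥ y) (w -ᵥ y) (z -ᵥ y)
      (trans (sym (sqDist-flip y z)) yz) xy wy
      (trans (sym (sqDist-via-base y x z)) xz) (trans (sym (sqDist-via-base y w z)) wz)
      (λ a≡b → x≢w (-ᵥ-cancelʳ y a≡b))

  private
    half : Carrier
    half = ιℕ 2 ⁻¹⟨ 2≢0 ⟩

    2*half≡1 : ιℕ 2 * half ≡ ιℕ 1
    2*half≡1 = trans (x*x⁻¹≡1 (ιℕ 2) 2≢0) (sym (+-identityʳ 1ᴿ))

    √3-spec : Σ Carrier λ s → 1ᴿ ≤ s × s * s ≡ ιℕ 3
    √3-spec = √-exists (ιℕ 3) (1≤ιℕ-suc 2)

    √3 : Carrier
    √3 = proj₁ √3-spec

    √3*√3≡3 : √3 * √3 ≡ ιℕ 3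
    √3*√3≡3 = proj₂ (proj₂ √3-spec)

    half≢0 : half ≢ 0ᴿ
    half≢0 half≡0 = 1≤x⇒x≢0 (1≤ιℕ-suc 0) (trans (sym 2*half≡1) (trans (cong (ιℕ 2 *_) half≡0) (zeroʳ _)))

    height≢0 : √3 * half ≢ 0ᴿ
    height≢0 eq = half≢0 (x*y≡0⇒x≡0 √3≢0 (trans (*-comm half √3) eq))
      where
      √3≢0 : √3 ≢ 0ᴿ
      √3≢0 = 1≤x⇒x≢0 (proj₁ (proj₂ √3-spec))

    ιℤ-norm : ∀ x y → ιℤ (norm x y) ≡ ιℤ x * ιℤ x + ιℤ x * ιℤ y + ιℤ y * ιℤ y
    ιℤ-norm x y rewrite ιℤ-+ (x ℤ.* x ℤ.+ x ℤ.* y) (y ℤ.* y) | ιℤ-+ (x ℤ.* x) (x ℤ.* y)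
                      | ιℤ-* x x | ιℤ-* x y | ιℤ-* y y = refl

  embed : ℤ × ℤ → Point
  embed (A , B) = (ιℤ A + ιℤ B * half , ιℤ B * (√3 * half))

  sqDist-embed : ∀ u v → sqDist ℝ (embed u) (embed v) ≡ ιℤ (dist² u v)
  sqDist-embed (A , B) (A′ , B′) = begin
    sqDist ℝ (embed (A , B)) (embed (A′ , B′))
      ≡⟨ solve 6 (λ a b a′ b′ i r →
           (a :+ b :* i :- (a′ :+ b′ :* i)) :* (a :+ b :* i :- (a′ :+ b′ :* i))
           :+ (b :* (r :* i) :- b′ :* (r :* i)) :* (b :* (r :* i) :- b′ :* (r :* i))
           := (a :- a′) :* (a :- a′) :+ (a :- a′) :* (b :- b′) :* (con (pos 2) :* i)
              :+ (b :- b′) :* (b :- b′) :* ((con (pos 2) :* i) :* (con (pos 2) :* i))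
              :+ (b :- b′) :* (b :- b′) :* (i :* i) :* (r :* r :- con (pos 3)))
           refl (ιℤ A) (ιℤ B) (ιℤ A′) (ιℤ B′) half √3 ⟩
    α * α + α * β * (ιℕ 2 * half) + β * β * ((ιℕ 2 * half) * (ιℕ 2 * half)) + β * β * (half * half) * (√3 * √3 - ιℕ 3)
      ≡⟨ cong₂ (λ t u → α * α + α * β * t + β * β * (t * t) + β * β * (half * half) * (u - ιℕ 3)) 2*half≡1 √3*√3≡3 ⟩
    α * α + α * β * ιℕ 1 + β * β * (ιℕ 1 * ιℕ 1) + β * β * (half * half) * (ιℕ 3 - ιℕ 3)
      ≡⟨ solve 3 (λ α β i → α :* α :+ α :* β :* con (pos 1) :+ β :* β :* (con (pos 1) :* con (pos 1))
                            :+ β :* β :* (i :* i) :* (con (pos 3) :- con (pos 3))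
                            := α :* α :+ α :* β :+ β :* β) refl α β half ⟩
    α * α + α * β + β * β
      ≡⟨ sym (trans (ιℤ-norm (A ℤ.- A′) (B ℤ.- B′)) (cong₂ (λ t u → t * t + t * u + u * u) (ιℤ-- A A′) (ιℤ-- B B′))) ⟩
    ιℤ (norm (A ℤ.- A′) (B ℤ.- B′)) ∎
    where
    open ≡-Reasoning
    α β : Carrier
    α = ιℤ A - ιℤ A′
    β = ιℤ B - ιℤ B′

  embed-injective : ∀ u v → embed u ≡ embed v → u ≡ v
  embed-injective (A , B) (A′ , B′) eq = cong₂ _,_ A≡A′ B≡B′
    where
    B≡B′ : B ≡ B′
    B≡B′ = ιℤ-injective B B′ (*-cancelʳ-≡ _ height≢0 (cong proj₂ eq))
    A≡A′ : A ≡ A′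
    A≡A′ = ιℤ-injective A A′ (+-cancelʳ-≡ (ιℤ B * half)
             (trans (cong proj₁ eq) (cong (λ t → ιℤ A′ + ιℤ t * half) (sym B≡B′))))

  private
    ιℤ-1 : ιℤ (pos 1) ≡ 1ᴿ
    ιℤ-1 = +-identityʳ 1ᴿ

  sqDist-embed≡1⇒dist²≡1 : ∀ u v → sqDist ℝ (embed u) (embed v) ≡ 1ᴿ → dist² u v ≡ pos 1
  sqDist-embed≡1⇒dist²≡1 u v eq = ιℤ-injective _ _ (trans (sym (sqDist-embed u v)) (trans eq (sym ιℤ-1)))

  dist²≡1⇒sqDist-embed≡1 : ∀ u v → dist² u v ≡ pos 1 → sqDist ℝ (embed u) (embed v) ≡ 1ᴿ
  dist²≡1⇒sqDist-embed≡1 u v eq = trans (sqDist-embed u v) (trans (cong ιℤ eq) ιℤ-1)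

  frame : Point → Point → Point → Cell → Point
  frame (s₁ , s₂) (t₁ , t₂) (u₁ , u₂) (a , d) =
    (s₁ + ιℕ a * (t₁ - s₁) - ιℕ d * (t₁ - u₁) , s₂ + ιℕ a * (t₂ - s₂) - ιℕ d * (t₂ - u₂))

  frame-origin : ∀ S T U → frame S T U (0 , 0) ≡ S
  frame-origin (s₁ , s₂) (t₁ , t₂) (u₁ , u₂) = cong₂ _,_ (eq s₁ t₁ u₁) (eq s₂ t₂ u₂)
    where
    eq : ∀ s t u → s + ιℕ 0 * (t - s) - ιℕ 0 * (t - u) ≡ s
    eq = solve 3 (λ s t u → s :+ con (pos 0) :* (t :- s) :- con (pos 0) :* (t :- u) := s) refl

  frame-east : ∀ S T U → frame S T U (1 , 0) ≡ T
  frame-east (s₁ , s₂) (t₁ , t₂) (u₁ , u₂) = cong₂ _,_ (eq s₁ t₁ u₁) (eq s₂ t₂ u₂)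
    where
    eq : ∀ s t u → s + ιℕ 1 * (t - s) - ιℕ 0 * (t - u) ≡ t
    eq = solve 3 (λ s t u → s :+ con (pos 1) :* (t :- s) :- con (pos 0) :* (t :- u) := t) refl

  frame-southeast : ∀ S T U → frame S T U (1 , 1) ≡ U
  frame-southeast (s₁ , s₂) (t₁ , t₂) (u₁ , u₂) = cong₂ _,_ (eq s₁ t₁ u₁) (eq s₂ t₂ u₂)
    where
    eq : ∀ s t u → s + ιℕ 1 * (t - s) - ιℕ 1 * (t - u) ≡ u
    eq = solve 3 (λ s t u → s :+ con (pos 1) :* (t :- s) :- con (pos 1) :* (t :- u) := u) refl

  frame-row₀ : ∀ S T U U′ a → frame S T U (a , 0) ≡ frame S T U′ (a , 0)
  frame-row₀ (s₁ , s₂) (t₁ , t₂) (u₁ , u₂) (u₁′ , u₂′) a = cong₂ _,_ (eq s₁ t₁ u₁ u₁′) (eq s₂ t₂ u₂ u₂′)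
    where
    eq : ∀ s t u u′ → s + ιℕ a * (t - s) - ιℕ 0 * (t - u) ≡ s + ιℕ a * (t - s) - ιℕ 0 * (t - u′)
    eq s t u u′ = cong (λ z → s + ιℕ a * (t - s) - z) (trans (zeroˡ _) (sym (zeroˡ _)))

  private
    ιℕ-sum : ∀ m₁ m₂ m₃ m₄ → m₁ ℕ.+ m₂ ≡ m₃ ℕ.+ m₄ → ιℕ m₄ ≡ ιℕ m₁ + ιℕ m₂ - ιℕ m₃
    ιℕ-sum m₁ m₂ m₃ m₄ eq = +-cancelʳ-≡ (ιℕ m₃) (begin
      ιℕ m₄ + ιℕ m₃                  ≡⟨ +-comm _ _ ⟩
      ιℕ m₃ + ιℕ m₄                  ≡⟨ sym (ιℕ-+ m₃ m₄) ⟩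
      ιℕ (m₃ ℕ.+ m₄)                 ≡⟨ cong ιℕ (sym eq) ⟩
      ιℕ (m₁ ℕ.+ m₂)                 ≡⟨ ιℕ-+ m₁ m₂ ⟩
      ιℕ m₁ + ιℕ m₂                  ≡⟨ solve 3 (λ x y z → x :+ y := x :+ y :- z :+ z) refl (ιℕ m₁) (ιℕ m₂) (ιℕ m₃) ⟩
      ιℕ m₁ + ιℕ m₂ - ιℕ m₃ + ιℕ m₃   ∎)
      where open ≡-Reasoning

    frame-coordinate-affine : ∀ s t u a₁ a₂ a₃ d₁ d₂ d₃ →
      s + (a₁ + a₂ - a₃) * (t - s) - (d₁ + d₂ - d₃) * (t - u)
      ≡ (s + a₁ * (t - s) - d₁ * (t - u)) + (s + a₂ * (t - s) - d₂ * (t - u)) - (s + a₃ * (t - s) - d₃ * (t - u))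
    frame-coordinate-affine = solve 9 (λ s t u a₁ a₂ a₃ d₁ d₂ d₃ →
      s :+ (a₁ :+ a₂ :- a₃) :* (t :- s) :- (d₁ :+ d₂ :- d₃) :* (t :- u)
      := (s :+ a₁ :* (t :- s) :- d₁ :* (t :- u)) :+ (s :+ a₂ :* (t :- s) :- d₂ :* (t :- u))
         :- (s :+ a₃ :* (t :- s) :- d₃ :* (t :- u))) refl

  frame-parallelogram : ∀ S T U c₁ c₂ c₃ c₄ → c₁ ⊕ c₂ ≡ c₃ ⊕ c₄ →
                        frame S T U c₄ ≡ frame S T U c₁ +ᵥ frame S T U c₂ -ᵥ frame S T U c₃
  frame-parallelogram (s₁ , s₂) (t₁ , t₂) (u₁ , u₂) (a₁ , d₁) (a₂ , d₂) (a₃ , d₃) (a₄ , d₄) eq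
    rewrite ιℕ-sum a₁ a₂ a₃ a₄ (cong proj₁ eq) | ιℕ-sum d₁ d₂ d₃ d₄ (cong proj₂ eq) =
    cong₂ _,_ (frame-coordinate-affine s₁ t₁ u₁ (ιℕ a₁) (ιℕ a₂) (ιℕ a₃) (ιℕ d₁) (ιℕ d₂) (ιℕ d₃))
              (frame-coordinate-affine s₂ t₂ u₂ (ιℕ a₁) (ιℕ a₂) (ιℕ a₃) (ιℕ d₁) (ιℕ d₂) (ιℕ d₃))

module Construction where
  open import Data.Sum.Function.Propositional using (_⊎-↔_)
  open import Function.Construct.Composition using (_↔-∘_)
  open import Function.Construct.Identity using (↔-id)
  open import Relation.Binary using (tri<; tri≈; tri>)

  open Lattice
  open import Data.Nat.Base using (_≤_)

  fourfold : ℕ → ℕ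
  fourfold zero    = zero
  fourfold (suc n) = 4 ℕ.+ fourfold n

  fourfold-mono : ∀ {m n} → m < n → 4 ℕ.+ fourfold m ≤ fourfold n
  fourfold-mono {zero}  {suc n} _         = s≤s (s≤s (s≤s (s≤s z≤n)))
  fourfold-mono {suc m} {suc n} (s≤s m<n) = s≤s (s≤s (s≤s (s≤s (fourfold-mono m<n))))

  fourfold-close⇒≡ : ∀ m n → fourfold m ≤ 3 ℕ.+ fourfold n → fourfold n ≤ 3 ℕ.+ fourfold m → m ≡ n
  fourfold-close⇒≡ m n m≲n n≲m with ℕP.<-cmp m n
  ... | tri≈ _ m≡n _ = m≡n
  ... | tri< m<n _ _ = ⊥-elim (ℕP.<⇒≱ (ℕP.≤-trans (s≤s (ℕP.≤-refl)) (fourfold-mono m<n)) n≲m)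
  ... | tri> _ _ n<m = ⊥-elim (ℕP.<⇒≱ (ℕP.≤-trans (s≤s (ℕP.≤-refl)) (fourfold-mono n<m)) m≲n)

  -- Gadget i of G X hangs off the strip at columns 4i + 4 and 4i + 5.  If
  -- i ∈ X it points towards the line through the special vertices and its
  -- tip lies on that line; otherwise it points away.
  pattern base = Fin.zero
  pattern side = Fin.suc Fin.zero
  pattern tip  = Fin.suc (Fin.suc Fin.zero)

  gadgetCell : Bool → Fin 3 → ℕ → Cell
  gadgetCell true  base x = (4 ℕ.+ x , 1)
  gadgetCell true  side x = (5 ℕ.+ x , 1)
  gadgetCell true  tip  x = (4 ℕ.+ x , 0)
  gadgetCell false base x = (5 ℕ.+ x , 4)
  gadgetCell false side x = (5 ℕ.+ x , 5)
  gadgetCell false tip  x = (5 ℕ.+ x , 6)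

  gadgetCell-column : ∀ b k x → 4 ℕ.+ x ≤ proj₁ (gadgetCell b k x) × proj₁ (gadgetCell b k x) ≤ 5 ℕ.+ x
  gadgetCell-column true  base x = ℕP.≤-refl , ℕP.n≤1+n _
  gadgetCell-column true  side x = ℕP.n≤1+n _ , ℕP.≤-refl
  gadgetCell-column true  tip  x = ℕP.≤-refl , ℕP.n≤1+n _
  gadgetCell-column false base x = ℕP.n≤1+n _ , ℕP.≤-refl
  gadgetCell-column false side x = ℕP.n≤1+n _ , ℕP.≤-refl
  gadgetCell-column false tip  x = ℕP.n≤1+n _ , ℕP.≤-refl

  gadgetCell-injective : ∀ b k k′ x → gadgetCell b k x ≡ gadgetCell b k′ x → k ≡ k′
  gadgetCell-injective true  base base x _  = refl
  gadgetCell-injective true  base side x ()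
  gadgetCell-injective true  base tip  x ()
  gadgetCell-injective true  side base x ()
  gadgetCell-injective true  side side x _  = refl
  gadgetCell-injective true  side tip  x ()
  gadgetCell-injective true  tip  base x ()
  gadgetCell-injective true  tip  side x ()
  gadgetCell-injective true  tip  tip  x _  = refl
  gadgetCell-injective false base base x _  = refl
  gadgetCell-injective false base side x ()
  gadgetCell-injective false base tip  x ()
  gadgetCell-injective false side base x ()
  gadgetCell-injective false side side x _  = refl
  gadgetCell-injective false side tip  x ()
  gadgetCell-injective false tip  base x ()
  gadgetCell-injective false tip  side x ()
  gadgetCell-injective false tip  tip  x _  = refl

  module Family (N : ℕ) where

    -- Long enough for the strip to reach past the last gadget.
    M : ℕ
    M = suc (fourfold N)

    Code : Set
    Code = (Fin 2 ⊎ (Fin M ⊎ Fin M)) ⊎ (Fin N × Fin 3)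

    pattern neck j     = inj₁ (inj₁ j)
    pattern upper j    = inj₁ (inj₂ (inj₁ j))
    pattern lower j    = inj₁ (inj₂ (inj₂ j))
    pattern gadget i k = inj₂ (i , k)

    m : ℕ
    m = (2 ℕ.+ (M ℕ.+ M)) ℕ.+ N ℕ.* 3

    code↔ : Fin m ↔ Code
    code↔ = ((↔-id (Fin 2) ⊎-↔ FinP.+↔⊎) ↔-∘ FinP.+↔⊎ ⊎-↔ FinP.*↔×) ↔-∘ FinP.+↔⊎

    offset : Fin N → ℕ
    offset i = fourfold (toℕ i)

    cellOf : Subset N → Code → Cell
    cellOf X (neck j)     = (1 ℕ.+ toℕ j , 1)
    cellOf X (upper j)    = (2 ℕ.+ toℕ j , 2)
    cellOf X (lower j)    = (3 ℕ.+ toℕ j , 3)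
    cellOf X (gadget i k) = gadgetCell (lookup X i) k (offset i)

    Node : Set
    Node = Fin 2 ⊎ Code

    cell : Subset N → Node → Cell
    cell X (inj₁ j) = (toℕ j , 0)
    cell X (inj₂ c) = cellOf X c

    code : Fin m → Code
    code = Inverse.to code↔

    node : Fin 2 ⊎ Fin m → Node
    node (inj₁ j) = inj₁ j
    node (inj₂ a) = inj₂ (code a)

    vertex : Node → Fin 2 ⊎ Fin m
    vertex (inj₁ j) = inj₁ j
    vertex (inj₂ c) = inj₂ (Inverse.from code↔ c)

    node-vertex : ∀ n → node (vertex n) ≡ n
    node-vertex (inj₁ j) = refl
    node-vertex (inj₂ c) = cong inj₂ (Inverse.strictlyInverseˡ code↔ c)

    vertex-node : ∀ v → vertex (node v) ≡ v
    vertex-node (inj₁ j) = refl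
    vertex-node (inj₂ a) = cong inj₂ (Inverse.strictlyInverseʳ code↔ a)

    G : Subset N → LGraph 2
    G X = record
      { m      = m
      ; adj    = λ u v → unitAdj (cell X (node u)) (cell X (node v))
      ; sym    = λ u v → unitAdj-sym (cell X (node u)) (cell X (node v))
      ; irrefl = λ v → unitAdj-irrefl (cell X (node v))
      }

    private
      columns-close : ∀ {x y a} → 4 ℕ.+ x ≤ a → a ≤ 5 ℕ.+ y → x ≤ 3 ℕ.+ y
      columns-close {x} {y} 4+x≤a a≤5+y =
        ℕP.≤-trans (ℕP.+-cancelˡ-≤ 4 x (1 ℕ.+ y) (ℕP.≤-trans 4+x≤a a≤5+y)) (ℕP.+-monoˡ-≤ y (s≤s z≤n))

      4+x≰3 : ∀ x → ¬ (4 ℕ.+ x ≤ 3)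
      4+x≰3 x (s≤s (s≤s (s≤s ())))

      narrow≢gadget : ∀ {a r} b k x → a ≤ 3 → (a , r) ≢ gadgetCell b k x
      narrow≢gadget b k x a≤3 eq =
        4+x≰3 x (ℕP.≤-trans (proj₁ (gadgetCell-column b k x)) (subst (_≤ 3) (cong proj₁ eq) a≤3))

      spine≢gadget : ∀ X s b k x → cellOf X (inj₁ s) ≢ gadgetCell b k x
      spine≢gadget X (inj₁ j) b k x = narrow≢gadget b k x (s≤s (ℕP.m≤n⇒m≤1+n (FinP.toℕ≤pred[n] {2} j)))
      spine≢gadget X (inj₂ (inj₁ j)) true  base x ()
      spine≢gadget X (inj₂ (inj₁ j)) true  side x ()
      spine≢gadget X (inj₂ (inj₁ j)) true  tip  x ()
      spine≢gadget X (inj₂ (inj₁ j)) false base x ()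
      spine≢gadget X (inj₂ (inj₁ j)) false side x ()
      spine≢gadget X (inj₂ (inj₁ j)) false tip  x ()
      spine≢gadget X (inj₂ (inj₂ j)) true  base x ()
      spine≢gadget X (inj₂ (inj₂ j)) true  side x ()
      spine≢gadget X (inj₂ (inj₂ j)) true  tip  x ()
      spine≢gadget X (inj₂ (inj₂ j)) false base x ()
      spine≢gadget X (inj₂ (inj₂ j)) false side x ()
      spine≢gadget X (inj₂ (inj₂ j)) false tip  x ()

      gadget-index : ∀ X i i′ k k′ → cellOf X (gadget i k) ≡ cellOf X (gadget i′ k′) → i ≡ i′
      gadget-index X i i′ k k′ eq = FinP.toℕ-injective (fourfold-close⇒≡ (toℕ i) (toℕ i′)
        (columns-close (proj₁ col) (subst (_≤ 5 ℕ.+ offset i′) (sym (cong proj₁ eq)) (proj₂ col′)))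
        (columns-close (proj₁ col′) (subst (_≤ 5 ℕ.+ offset i) (cong proj₁ eq) (proj₂ col))))
        where
        col : 4 ℕ.+ offset i ≤ proj₁ (cellOf X (gadget i k)) × proj₁ (cellOf X (gadget i k)) ≤ 5 ℕ.+ offset i
        col = gadgetCell-column (lookup X i) k (offset i)
        col′ : 4 ℕ.+ offset i′ ≤ proj₁ (cellOf X (gadget i′ k′)) × proj₁ (cellOf X (gadget i′ k′)) ≤ 5 ℕ.+ offset i′
        col′ = gadgetCell-column (lookup X i′) k′ (offset i′)

    cellOf-injective : ∀ X c c′ → cellOf X c ≡ cellOf X c′ → c ≡ c′
    cellOf-injective X (neck j)  (neck j′)  eq = cong neck (FinP.toℕ-injective (ℕP.suc-injective (cong proj₁ eq)))
    cellOf-injective X (neck _)  (upper _)  ()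
    cellOf-injective X (neck _)  (lower _)  ()
    cellOf-injective X (upper _) (neck _)   ()
    cellOf-injective X (upper j) (upper j′) eq =
      cong upper (FinP.toℕ-injective (ℕP.+-cancelˡ-≡ 2 _ _ (cong proj₁ eq)))
    cellOf-injective X (upper _) (lower _)  ()
    cellOf-injective X (lower _) (neck _)   ()
    cellOf-injective X (lower _) (upper _)  ()
    cellOf-injective X (lower j) (lower j′) eq =
      cong lower (FinP.toℕ-injective (ℕP.+-cancelˡ-≡ 3 _ _ (cong proj₁ eq)))
    cellOf-injective X (inj₁ s) (gadget i k) eq = ⊥-elim (spine≢gadget X s (lookup X i) k (offset i) eq)
    cellOf-injective X (gadget i k) (inj₁ s) eq = ⊥-elim (spine≢gadget X s (lookup X i) k (offset i) (sym eq))
    cellOf-injective X (gadget i k) (gadget i′ k′) eq with gadget-index X i i′ k k′ eq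
    ... | refl = cong (gadget i) (gadgetCell-injective (lookup X i) k k′ (offset i) eq)

    private
      special≢code : ∀ X j c → (toℕ j , 0) ≢ cellOf X c
      special≢code X j (neck _)     ()
      special≢code X j (upper _)    ()
      special≢code X j (lower _)    ()
      special≢code X j (gadget i k) =
        narrow≢gadget (lookup X i) k (offset i) (ℕP.≤-trans (FinP.toℕ≤pred[n] {2} j) (s≤s z≤n))

    cell-injective : ∀ X u v → cell X u ≡ cell X v → u ≡ v
    cell-injective X (inj₁ j) (inj₁ j′) eq = cong inj₁ (FinP.toℕ-injective (cong proj₁ eq))
    cell-injective X (inj₁ j) (inj₂ c)  eq = ⊥-elim (special≢code X j c eq)
    cell-injective X (inj₂ c) (inj₁ j)  eq = ⊥-elim (special≢code X j c (sym eq))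
    cell-injective X (inj₂ c) (inj₂ c′) eq = cong inj₂ (cellOf-injective X c c′ eq)

    data Shallow (X : Subset N) : Cell → Set where
      shallow-neck   : ∀ {a} → a ≤ 2 → Shallow X (a , 1)
      shallow-gadget : ∀ {a d} i → lookup X i ≡ true → 4 ℕ.+ offset i ≤ a → a ≤ 5 ℕ.+ offset i → Shallow X (a , d)

    shallow : ∀ X c → proj₂ (cellOf X c) ≤ 1 → Shallow X (cellOf X c)
    shallow X (neck j)  _ = shallow-neck (s≤s (FinP.toℕ≤pred[n] j))
    shallow X (upper j) (s≤s ())
    shallow X (lower j) (s≤s ())
    shallow X (gadget i k) depth≤1 with lookup X i in i∈X
    ... | true  = let col = gadgetCell-column true k (offset i) in shallow-gadget i i∈X (proj₁ col) (proj₂ col)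
    shallow X (gadget i base) (s≤s ()) | false
    shallow X (gadget i side) (s≤s ()) | false
    shallow X (gadget i tip)  (s≤s ()) | false

    shallow-crossNear : ∀ {A B c c′} → Shallow A c → Shallow B c′ → CrossNear c c′ →
                        Σ (Fin N) λ i → lookup A i ≡ true × lookup B i ≡ true
    shallow-crossNear (shallow-neck _) (shallow-neck _) (s≤s () , _)
    shallow-crossNear {c′ = a′ , _} (shallow-neck {a} a≤2) (shallow-gadget k _ 4+k≤a′ _) (_ , _ , 1+a′≤1+a) =
      ⊥-elim (4+x≰3 (offset k) (ℕP.≤-trans 4+k≤a′ (ℕP.≤-trans (ℕP.≤-pred 1+a′≤1+a) (ℕP.m≤n⇒m≤1+n a≤2))))
    shallow-crossNear {c = a , d} (shallow-gadget i _ 4+i≤a _) (shallow-neck {a′} a′≤2) (d+1≤1 , a≤1+d+a′ , _)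
      with ℕP.n≤0⇒n≡0 (ℕP.≤-pred (subst (_≤ 1) (ℕP.+-comm d 1) d+1≤1))
    ... | refl = ⊥-elim (4+x≰3 (offset i) (ℕP.≤-trans 4+i≤a (ℕP.≤-trans a≤1+d+a′ (s≤s a′≤2))))
    shallow-crossNear {B = B} {c = a , d} {c′ = a′ , d′} (shallow-gadget i i∈A 4+i≤a a≤5+i) (shallow-gadget k k∈B 4+k≤a′ a′≤5+k)
                      (d+d′≤1 , a≤1+d+a′ , d+a′≤1+a) =
      i , i∈A , subst (λ j → lookup B j ≡ true) (sym i≡k) k∈B
      where
      open ℕP.≤-Reasoning
      d≤1 : d ≤ 1
      d≤1 = ℕP.m+n≤o⇒m≤o d d+d′≤1
      i≡k : i ≡ k
      i≡k = FinP.toℕ-injective (fourfold-close⇒≡ (toℕ i) (toℕ k)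
        (ℕP.+-cancelˡ-≤ 4 _ _ (begin
          4 ℕ.+ offset i          ≤⟨ 4+i≤a ⟩
          a                       ≤⟨ a≤1+d+a′ ⟩
          suc (d ℕ.+ a′)          ≤⟨ s≤s (ℕP.+-mono-≤ d≤1 a′≤5+k) ⟩
          4 ℕ.+ (3 ℕ.+ offset k)  ∎))
        (ℕP.≤-trans (ℕP.+-cancelˡ-≤ 4 _ _ (begin
          4 ℕ.+ offset k          ≤⟨ 4+k≤a′ ⟩
          a′                      ≤⟨ ℕP.m≤n+m a′ d ⟩
          d ℕ.+ a′                ≤⟨ d+a′≤1+a ⟩
          suc a                   ≤⟨ s≤s a≤5+i ⟩
          4 ℕ.+ (2 ℕ.+ offset i)  ∎)) (ℕP.n≤1+n _)))

    isNeck : Code → Bool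
    isNeck (neck _) = true
    isNeck _        = false

    private
      far-from-specials : ∀ {a d} → 2 ≤ d ⊎ 3 ≤ a →
                          unitAdj (0 , 0) (a , d) ∨ (unitAdj (1 , 0) (a , d) ∨ false) ≡ false
      far-from-specials far =
        cong₂ (λ x y → x ∨ (y ∨ false)) (¬Near⇒¬unitAdj (apart z≤n far)) (¬Near⇒¬unitAdj (apart (s≤s z≤n) far))
        where
        apart : ∀ {s a d} → s ≤ 1 → 2 ≤ d ⊎ 3 ≤ a → ¬ (Near s a × Near d 0)
        apart s≤1 (inj₁ 2≤d) (_ , d≤1 , _)     = ℕP.<⇒≱ 2≤d d≤1
        apart s≤1 (inj₂ 3≤a) ((_ , a≤1+s) , _) = ℕP.<⇒≱ 3≤a (ℕP.≤-trans a≤1+s (s≤s s≤1))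

    touches-special≡isNeck : ∀ X c → unitAdj (0 , 0) (cellOf X c) ∨ (unitAdj (1 , 0) (cellOf X c) ∨ false) ≡ isNeck c
    touches-special≡isNeck X (neck Fin.zero)           = cong (_∨ (unitAdj (1 , 0) (1 , 1) ∨ false)) (adj-SE 0 0)
    touches-special≡isNeck X (neck (Fin.suc Fin.zero)) =
      cong₂ (λ x y → x ∨ (y ∨ false)) (¬Near⇒¬unitAdj λ { ((_ , s≤s ()) , _) }) (adj-SE 1 0)
    touches-special≡isNeck X (upper _)    = far-from-specials (inj₁ (s≤s (s≤s z≤n)))
    touches-special≡isNeck X (lower _)    = far-from-specials (inj₁ (s≤s (s≤s z≤n)))
    touches-special≡isNeck X (gadget i k) =
      far-from-specials (inj₂ (ℕP.≤-trans (ℕP.m≤m+n 3 (suc (offset i)))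
                                          (proj₁ (gadgetCell-column (lookup X i) k (offset i)))))

    upperAt lowerAt : ∀ n → n < M → Node
    upperAt n h = inj₂ (upper (fromℕ< h))
    lowerAt n h = inj₂ (lower (fromℕ< h))

    upperAt-cell : ∀ X n (h : n < M) → cell X (upperAt n h) ≡ (2 ℕ.+ n , 2)
    upperAt-cell X n h = cong (λ j → (2 ℕ.+ j , 2)) (FinP.toℕ-fromℕ< h)

    lowerAt-cell : ∀ X n (h : n < M) → cell X (lowerAt n h) ≡ (3 ℕ.+ n , 3)
    lowerAt-cell X n h = cong (λ j → (3 ℕ.+ j , 3)) (FinP.toℕ-fromℕ< h)

module Gluing (N : ℕ) where
  import Data.Bool.Properties as BoolP

  open Lattice using (unitAdj)
  open Construction
  open Family N

  module _ (A B : Subset N) where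

    left right : Fin 2 ⊎ Fin m → GV (G A) (G B)
    left (inj₁ j)  = inj₁ j
    left (inj₂ a)  = inj₂ (inj₁ a)
    right (inj₁ j) = inj₁ j
    right (inj₂ b) = inj₂ (inj₂ b)

    left-injective : ∀ u v → left u ≡ left v → u ≡ v
    left-injective (inj₁ _) (inj₁ _) refl = refl
    left-injective (inj₂ _) (inj₂ _) refl = refl

    right-injective : ∀ u v → right u ≡ right v → u ≡ v
    right-injective (inj₁ _) (inj₁ _) refl = refl
    right-injective (inj₂ _) (inj₂ _) refl = refl

    left-adj : ∀ u v → gAdj (G A) (G B) (left u) (left v) ≡ LGraph.adj (G A) u v
    left-adj (inj₁ i) (inj₁ j) = BoolP.∨-idem _
    left-adj (inj₁ _) (inj₂ _) = refl
    left-adj (inj₂ _) (inj₁ _) = refl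
    left-adj (inj₂ _) (inj₂ _) = refl

    right-adj : ∀ u v → gAdj (G A) (G B) (right u) (right v) ≡ LGraph.adj (G B) u v
    right-adj (inj₁ i) (inj₁ j) = BoolP.∨-idem _
    right-adj (inj₁ _) (inj₂ _) = refl
    right-adj (inj₂ _) (inj₁ _) = refl
    right-adj (inj₂ _) (inj₂ _) = refl

    private
      lift-unit : ∀ X (e : Fin 2 ⊎ Fin m → GV (G A) (G B)) → (∀ u v → gAdj (G A) (G B) (e u) (e v) ≡ LGraph.adj (G X) u v) →
                  ∀ u v → unitAdj (cell X u) (cell X v) ≡ true → gAdj (G A) (G B) (e (vertex u)) (e (vertex v)) ≡ true
      lift-unit X e e-adj u v adj = trans (e-adj (vertex u) (vertex v))
        (subst₂ (λ x y → unitAdj (cell X x) (cell X y) ≡ true) (sym (node-vertex u)) (sym (node-vertex v)) adj)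

    left-unit : ∀ u v → unitAdj (cell A u) (cell A v) ≡ true → gAdj (G A) (G B) (left (vertex u)) (left (vertex v)) ≡ true
    left-unit = lift-unit A left left-adj

    right-unit : ∀ u v → unitAdj (cell B u) (cell B v) ≡ true → gAdj (G A) (G B) (right (vertex u)) (right (vertex v)) ≡ true
    right-unit = lift-unit B right right-adj

module Rigidity (ℝ : CompleteOrderedField) (N : ℕ) where
  open OrderedField ℝ using (1ᴿ)
  open Plane ℝ
  open Lattice
  open Construction
  open Family N

  module _ (X : Subset N) (p : Node → Point)
           (p-injective : ∀ u v → p u ≡ p v → u ≡ v)
           (p-unit : ∀ u v → unitAdj (cell X u) (cell X v) ≡ true → sqDist ℝ (p u) (p v) ≡ 1ᴿ) where

    F : Cell → Point
    F = frame (p (inj₁ Fin.zero)) (p (inj₁ (Fin.suc Fin.zero))) (p (inj₂ (neck Fin.zero)))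

    record Located (v : Node) (c : Cell) : Set where
      field
        cell≡     : cell X v ≡ c
        position≡ : p v ≡ F c
    open Located

    private
      unit-at : ∀ {u v cu cv} → cell X u ≡ cu → cell X v ≡ cv → unitAdj cu cv ≡ true → sqDist ℝ (p u) (p v) ≡ 1ᴿ
      unit-at refl refl = p-unit _ _

    -- x is the fourth vertex of the rhombus on w, y, z; its edges to y and z,
    -- and x ≠ w, are forced by the lattice.
    located : ∀ {x y z w cx cy cz cw} → cell X x ≡ cx → Located y cy → Located z cz → Located w cw →
              unitAdj cy cz ≡ true → unitAdj cw cy ≡ true → unitAdj cw cz ≡ true → cy ⊕ cz ≡ cw ⊕ cx →
              Located x cx
    located {x} {y} {z} {w} {cx} {cy} {cz} {cw} x↦ y↦ z↦ w↦ yz wy wz eq = record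
      { cell≡     = x↦
      ; position≡ = begin
          p x                    ≡⟨ rhombus (p x) (p y) (p z) (p w) (unit-at (cell≡ y↦) (cell≡ z↦) yz)
                                      (unit-at (cell≡ w↦) (cell≡ y↦) wy) (unit-at (cell≡ w↦) (cell≡ z↦) wz)
                                      (unit-at x↦ (cell≡ y↦) xy) (unit-at x↦ (cell≡ z↦) xz) px≢pw ⟩
          p y +ᵥ p z -ᵥ p w       ≡⟨ cong₂ _-ᵥ_ (cong₂ _+ᵥ_ (position≡ y↦) (position≡ z↦)) (position≡ w↦) ⟩
          F cy +ᵥ F cz -ᵥ F cw    ≡⟨ sym (frame-parallelogram _ _ _ cy cz cw cx eq) ⟩
          F cx                   ∎
      }
      where
      open ≡-Reasoning
      xy : unitAdj cx cy ≡ true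
      xy = trans (sym (unitAdj-parallelogram cz cy cw cx (trans (⊕-comm cz cy) eq))) (trans (unitAdj-sym cz cw) wz)
      xz : unitAdj cx cz ≡ true
      xz = trans (sym (unitAdj-parallelogram cy cz cw cx eq)) (trans (unitAdj-sym cy cw) wy)
      cx≢cw : cx ≢ cw
      cx≢cw refl with () ← trans (sym (unitAdj-midpoint cw cy cz eq (trans (unitAdj-sym cy cw) wy))) yz
      px≢pw : p x ≢ p w
      px≢pw px≡pw = cx≢cw (trans (sym x↦) (trans (cong (cell X) (p-injective x w px≡pw)) (cell≡ w↦)))

    private
      s t neck₀ neck₁ : Node
      s     = inj₁ Fin.zero
      t     = inj₁ (Fin.suc Fin.zero)
      neck₀ = inj₂ (neck Fin.zero)
      neck₁ = inj₂ (neck (Fin.suc Fin.zero))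

      <-pred : ∀ {n} → suc n < M → n < M
      <-pred = ℕP.<-trans (ℕP.n<1+n _)

      s↦ : Located s (0 , 0)
      s↦ = record { cell≡ = refl ; position≡ = sym (frame-origin _ _ _) }

      t↦ : Located t (1 , 0)
      t↦ = record { cell≡ = refl ; position≡ = sym (frame-east _ _ _) }

      neck₀↦ : Located neck₀ (1 , 1)
      neck₀↦ = record { cell≡ = refl ; position≡ = sym (frame-southeast _ _ _) }

      neck₁↦ : Located neck₁ (2 , 1)
      neck₁↦ = located refl t↦ neck₀↦ s↦ (adj-S 1 0) (adj-W 0 0) (adj-SE 0 0) refl

    private
      upper₀↦ : (h : 0 < M) → Located (upperAt 0 h) (2 , 2)
      upper₀↦ h = located (upperAt-cell X 0 h) neck₀↦ neck₁↦ t↦ (adj-W 1 1) (adj-S 1 0) (adj-SE 1 0) refl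

      upper₁↦ : (h : 1 < M) → Located (upperAt 1 h) (3 , 2)
      upper₁↦ h = located (upperAt-cell X 1 h) neck₁↦ (upper₀↦ (<-pred h)) neck₀↦ (adj-S 2 1) (adj-W 1 1) (adj-SE 1 1) refl

    upper↦ : ∀ n (h : n < M) → Located (upperAt n h) (2 ℕ.+ n , 2)
    lower↦ : ∀ n (h : suc n < M) → Located (lowerAt n (<-pred h)) (3 ℕ.+ n , 3)

    upper↦ zero          = upper₀↦
    upper↦ (suc zero)    = upper₁↦
    upper↦ (suc (suc n)) h =
      located (upperAt-cell X (2 ℕ.+ n) h) (lower↦ (suc n) h) (upper↦ (suc n) (<-pred h)) (lower↦ n (<-pred h))
              (adj-NW (3 ℕ.+ n) 2) (adj-W (3 ℕ.+ n) 3) (adj-N (3 ℕ.+ n) 2)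
              (cong (_, 5) (ℕP.+-comm (4 ℕ.+ n) (3 ℕ.+ n)))

    lower↦ zero h =
      located (lowerAt-cell X 0 (<-pred h)) (upper₀↦ (<-pred h)) (upper₁↦ h) neck₁↦ (adj-W 2 2) (adj-S 2 1) (adj-SE 2 1) refl
    lower↦ (suc n) h =
      located (lowerAt-cell X (suc n) (<-pred h))
              (upper↦ (suc n) (<-pred h)) (lower↦ n (<-pred h)) (upper↦ n (<-pred (<-pred h)))
              (adj-S (3 ℕ.+ n) 2) (adj-W (2 ℕ.+ n) 2) (adj-SE (2 ℕ.+ n) 2)
              (cong (λ k → (suc (suc k) , 5)) (sym (ℕP.+-suc n (3 ℕ.+ n))))

    private
      hanging↦ : ∀ {v} n (h : suc n < M) → cell X v ≡ (2 ℕ.+ n , 1) → Located v (2 ℕ.+ n , 1)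
      hanging↦ n h v↦ =
        located v↦ (upper↦ n (<-pred h)) (upper↦ (suc n) h) (lower↦ n h)
                (adj-W (2 ℕ.+ n) 2) (adj-NW (2 ℕ.+ n) 2) (adj-N (3 ℕ.+ n) 2)
                (cong (_, 4) (ℕP.+-comm (2 ℕ.+ n) (3 ℕ.+ n)))

    tip↦ : ∀ i → lookup X i ≡ true → p (inj₂ (gadget i tip)) ≡ F (4 ℕ.+ offset i , 0)
    tip↦ i i∈X = Located.position≡
      (located (gadget-cell tip) base↦ side↦ (upper↦ (3 ℕ.+ x) (<-pred 4+x<M))
               (adj-W (4 ℕ.+ x) 1) (adj-NW (4 ℕ.+ x) 1) (adj-N (5 ℕ.+ x) 1)
               (cong (_, 2) (ℕP.+-comm (4 ℕ.+ x) (5 ℕ.+ x))))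
      where
      x : ℕ
      x = offset i
      4+x<M : 4 ℕ.+ x < M
      4+x<M = s≤s (fourfold-mono (FinP.toℕ<n i))
      gadget-cell : ∀ k → cell X (inj₂ (gadget i k)) ≡ gadgetCell true k x
      gadget-cell k = cong (λ b → gadgetCell b k x) i∈X
      base↦ : Located (inj₂ (gadget i base)) (4 ℕ.+ x , 1)
      base↦ = hanging↦ (2 ℕ.+ x) (<-pred 4+x<M) (gadget-cell base)
      side↦ : Located (inj₂ (gadget i side)) (5 ℕ.+ x , 1)
      side↦ = hanging↦ (3 ℕ.+ x) 4+x<M (gadget-cell side)

module Realisation (ℝ : CompleteOrderedField) (N : ℕ) where
  open import Data.Fin.Subset.Properties using (x∈p∩q⁺; x∈p∩q⁻)
  open import Data.Integer using (ℤ) renaming (+_ to pos)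
  open import Data.Vec.Properties using ([]=⇒lookup; lookup⇒[]=)

  open OrderedField ℝ using (1ᴿ)
  open Plane ℝ
  open Lattice
  open Construction
  open Family N
  open Gluing N
  open Rigidity ℝ N

  node-injective : ∀ u v → node u ≡ node v → u ≡ v
  node-injective u v eq = trans (sym (vertex-node u)) (trans (cong vertex eq) (vertex-node v))

  private
    module Restrict {A B : Subset N} (X : Subset N) (e : Fin 2 ⊎ Fin m → GV (G A) (G B))
                    (e-injective : ∀ u v → e u ≡ e v → u ≡ v)
                    (e-unit : ∀ u v → unitAdj (cell X u) (cell X v) ≡ true → gAdj (G A) (G B) (e (vertex u)) (e (vertex v)) ≡ true)
                    (p : GV (G A) (G B) → Point) (p-injective : ∀ u v → p u ≡ p v → u ≡ v)
                    (p-unit : ∀ u v → gAdj (G A) (G B) u v ≡ true → sqDist ℝ (p u) (p v) ≡ 1ᴿ) where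
      q : Node → Point
      q n = p (e (vertex n))

      q-injective : ∀ u v → q u ≡ q v → u ≡ v
      q-injective u v eq = trans (sym (node-vertex u))
        (trans (cong node (e-injective _ _ (p-injective _ _ eq))) (node-vertex v))

      q-unit : ∀ u v → unitAdj (cell X u) (cell X v) ≡ true → sqDist ℝ (q u) (q v) ≡ 1ᴿ
      q-unit u v adj = p-unit _ _ (e-unit u v adj)

  -- If i ∈ A ∩ B, both copies of the tip of gadget i are pinned to the same
  -- point of the common line of the two copies.
  unitDistance⇒disjoint : ∀ A B → IsUnitDistance ℝ (glue (G A) (G B)) → Empty (A ∩ B)
  unitDistance⇒disjoint A B (p , p-injective , adj⇔) (i , i∈A∩B) = left≢right (p-injective _ _ tips-collide)
    where
    p-unit : ∀ u v → gAdj (G A) (G B) u v ≡ true → sqDist ℝ (p u) (p v) ≡ 1ᴿ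
    p-unit u v = Equivalence.to (adj⇔ u v)
    module L = Restrict A (left A B) (left-injective A B) (left-unit A B) p p-injective p-unit
    module R = Restrict B (right A B) (right-injective A B) (right-unit A B) p p-injective p-unit
    i∈A : lookup A i ≡ true
    i∈A = []=⇒lookup (proj₁ (x∈p∩q⁻ A B i∈A∩B))
    i∈B : lookup B i ≡ true
    i∈B = []=⇒lookup (proj₂ (x∈p∩q⁻ A B i∈A∩B))
    tips-collide : L.q (inj₂ (gadget i tip)) ≡ R.q (inj₂ (gadget i tip))
    tips-collide = trans (tip↦ A L.q L.q-injective L.q-unit i i∈A)
                    (trans (frame-row₀ _ _ _ _ (4 ℕ.+ offset i)) (sym (tip↦ B R.q R.q-injective R.q-unit i i∈B)))
    left≢right : ∀ {a b} → left A B (inj₂ a) ≢ right A B (inj₂ b)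
    left≢right ()

  -- If A ∩ B = ∅, the right copy sits below the line through the specials
  -- and the left copy is its mirror image above it.
  module _ (A B : Subset N) (A∩B≡∅ : Empty (A ∩ B)) where
    private
      Vertex : Set
      Vertex = GV (G A) (G B)

      latticePoint : Vertex → ℤ × ℤ
      latticePoint (inj₁ j)        = placeR (cell A (inj₁ j))
      latticePoint (inj₂ (inj₁ a)) = placeL (cell A (node (inj₂ a)))
      latticePoint (inj₂ (inj₂ b)) = placeR (cell B (node (inj₂ b)))

      latticePoint-left : ∀ u → latticePoint (left A B u) ≡ placeL (cell A (node u))
      latticePoint-left (inj₁ Fin.zero)           = refl
      latticePoint-left (inj₁ (Fin.suc Fin.zero)) = refl
      latticePoint-left (inj₂ _)                  = refl

      latticePoint-right : ∀ u → latticePoint (right A B u) ≡ placeR (cell B (node u))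
      latticePoint-right (inj₁ _) = refl
      latticePoint-right (inj₂ _) = refl

      ¬crossNear : ∀ a b → ¬ CrossNear (cell A (node (inj₂ a))) (cell B (node (inj₂ b)))
      ¬crossNear a b near@(d+d′≤1 , _) =
        let i , i∈A , i∈B = shallow-crossNear (shallow A (code a) (ℕP.m+n≤o⇒m≤o _ d+d′≤1))
                                              (shallow B (code b) (ℕP.m+n≤o⇒n≤o _ d+d′≤1)) near
        in A∩B≡∅ (i , x∈p∩q⁺ (lookup⇒[]= i A i∈A , lookup⇒[]= i B i∈B))

      separated-left : ∀ u v → latticePoint (left A B u) ≡ latticePoint (left A B v) → left A B u ≡ left A B v
      separated-left u v eq = cong (left A B) (node-injective u v (cell-injective A _ _
        (placeL-injective _ _ (trans (sym (latticePoint-left u)) (trans eq (latticePoint-left v))))))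

      separated-right : ∀ u v → latticePoint (right A B u) ≡ latticePoint (right A B v) → right A B u ≡ right A B v
      separated-right u v eq = cong (right A B) (node-injective u v (cell-injective B _ _
        (placeR-injective _ _ (trans (sym (latticePoint-right u)) (trans eq (latticePoint-right v))))))

      separated-cross : ∀ a b → latticePoint (inj₂ (inj₁ a)) ≢ latticePoint (inj₂ (inj₂ b))
      separated-cross a b eq = ¬crossNear a b (placeL≡placeR⇒CrossNear (cell A (node (inj₂ a))) (cell B (node (inj₂ b))) eq)

      latticePoint-injective : ∀ u v → latticePoint u ≡ latticePoint v → u ≡ v
      latticePoint-injective (inj₁ i)        (inj₁ j)         = separated-left (inj₁ i) (inj₁ j)
      latticePoint-injective (inj₁ i)        (inj₂ (inj₁ a))  = separated-left (inj₁ i) (inj₂ a)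
      latticePoint-injective (inj₁ i)        (inj₂ (inj₂ b))  = separated-right (inj₁ i) (inj₂ b)
      latticePoint-injective (inj₂ (inj₁ a)) (inj₁ j)         = separated-left (inj₂ a) (inj₁ j)
      latticePoint-injective (inj₂ (inj₁ a)) (inj₂ (inj₁ a′)) = separated-left (inj₂ a) (inj₂ a′)
      latticePoint-injective (inj₂ (inj₁ a)) (inj₂ (inj₂ b))  = ⊥-elim ∘ separated-cross a b
      latticePoint-injective (inj₂ (inj₂ b)) (inj₁ j)         = separated-right (inj₂ b) (inj₁ j)
      latticePoint-injective (inj₂ (inj₂ b)) (inj₂ (inj₁ a))  = ⊥-elim ∘ separated-cross a b ∘ sym
      latticePoint-injective (inj₂ (inj₂ b)) (inj₂ (inj₂ b′)) = separated-right (inj₂ b) (inj₂ b′)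

      Unit : Vertex → Vertex → Set
      Unit u v = dist² (latticePoint u) (latticePoint v) ≡ pos 1

      adj⇔unit-left : ∀ u v → (gAdj (G A) (G B) (left A B u) (left A B v) ≡ true) ⇔ Unit (left A B u) (left A B v)
      adj⇔unit-left u v = mk⇔
        (λ adj → trans dist≡ (unitAdj⇒dist²≡1 (cell A (node u)) (cell A (node v)) (trans (sym (left-adj A B u v)) adj)))
        (λ d≡1 → trans (left-adj A B u v) (dist²≡1⇒unitAdj (cell A (node u)) (cell A (node v)) (trans (sym dist≡) d≡1)))
        where
        dist≡ : dist² (latticePoint (left A B u)) (latticePoint (left A B v))
                ≡ dist² (placeR (cell A (node u))) (placeR (cell A (node v)))
        dist≡ = trans (cong₂ dist² (latticePoint-left u) (latticePoint-left v))
                      (dist²-placeL (cell A (node u)) (cell A (node v)))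

      adj⇔unit-right : ∀ u v → (gAdj (G A) (G B) (right A B u) (right A B v) ≡ true) ⇔ Unit (right A B u) (right A B v)
      adj⇔unit-right u v = mk⇔
        (λ adj → trans dist≡ (unitAdj⇒dist²≡1 (cell B (node u)) (cell B (node v)) (trans (sym (right-adj A B u v)) adj)))
        (λ d≡1 → trans (right-adj A B u v) (dist²≡1⇒unitAdj (cell B (node u)) (cell B (node v)) (trans (sym dist≡) d≡1)))
        where
        dist≡ : dist² (latticePoint (right A B u)) (latticePoint (right A B v))
                ≡ dist² (placeR (cell B (node u))) (placeR (cell B (node v)))
        dist≡ = cong₂ dist² (latticePoint-right u) (latticePoint-right v)

      adj⇔unit-cross : ∀ a b → (false ≡ true) ⇔ Unit (inj₂ (inj₁ a)) (inj₂ (inj₂ b))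
      adj⇔unit-cross a b = mk⇔ (λ ())
        (λ d≡1 → ⊥-elim (¬crossNear a b (dist²≡1⇒CrossNear (cell A (node (inj₂ a))) (cell B (node (inj₂ b))) d≡1)))

      adj⇔unit : ∀ u v → (gAdj (G A) (G B) u v ≡ true) ⇔ Unit u v
      adj⇔unit (inj₁ i)        (inj₁ j)         = adj⇔unit-left (inj₁ i) (inj₁ j)
      adj⇔unit (inj₁ i)        (inj₂ (inj₁ a))  = adj⇔unit-left (inj₁ i) (inj₂ a)
      adj⇔unit (inj₁ i)        (inj₂ (inj₂ b))  = adj⇔unit-right (inj₁ i) (inj₂ b)
      adj⇔unit (inj₂ (inj₁ a)) (inj₁ j)         = adj⇔unit-left (inj₂ a) (inj₁ j)
      adj⇔unit (inj₂ (inj₁ a)) (inj₂ (inj₁ a′)) = adj⇔unit-left (inj₂ a) (inj₂ a′)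
      adj⇔unit (inj₂ (inj₁ a)) (inj₂ (inj₂ b))  = adj⇔unit-cross a b
      adj⇔unit (inj₂ (inj₂ b)) (inj₁ j)         = adj⇔unit-right (inj₂ b) (inj₁ j)
      adj⇔unit (inj₂ (inj₂ b)) (inj₂ (inj₁ a))  =
        mk⇔ (λ ()) (λ d≡1 → Equivalence.from (adj⇔unit-cross a b)
                              (trans (dist²-sym (latticePoint (inj₂ (inj₁ a))) (latticePoint (inj₂ (inj₂ b)))) d≡1))
      adj⇔unit (inj₂ (inj₂ b)) (inj₂ (inj₂ b′)) = adj⇔unit-right (inj₂ b) (inj₂ b′)

    disjoint⇒unitDistance : IsUnitDistance ℝ (glue (G A) (G B))
    disjoint⇒unitDistance =
      (λ v → embed (latticePoint v)) ,
      (λ u v eq → latticePoint-injective u v (embed-injective (latticePoint u) (latticePoint v) eq)) ,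
      (λ u v → mk⇔
        (λ adj → dist²≡1⇒sqDist-embed≡1 (latticePoint u) (latticePoint v) (Equivalence.to (adj⇔unit u v) adj))
        (λ d≡1 → Equivalence.from (adj⇔unit u v) (sqDist-embed≡1⇒dist²≡1 (latticePoint u) (latticePoint v) d≡1)))

module Connectivity (N : ℕ) where
  open Lattice
  open Construction
  open Family N
  open Gluing N

  module _ (Γ : Graph) where
    walk-++ : ∀ {u v w} → Walk Γ u v → Walk Γ v w → Walk Γ u w
    walk-++ here         q = q
    walk-++ (step uw wv) q = step uw (walk-++ wv q)

    walk-reverse : ∀ {u v} → Walk Γ u v → Walk Γ v u
    walk-reverse here                 = here
    walk-reverse (step {u} {w} uw wv) = walk-++ (walk-reverse wv) (step (trans (Graph.sym Γ w u) uw) here)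

    connected-via : ∀ r → (∀ u → Walk Γ u r) → Connected Γ
    connected-via r to-r u v = walk-++ (to-r u) (walk-reverse (to-r v))

  data ToSpecial (X : Subset N) : Node → Set where
    here : ToSpecial X (inj₁ Fin.zero)
    step : ∀ {u v} → unitAdj (cell X u) (cell X v) ≡ true → ToSpecial X v → ToSpecial X u

  module _ (X : Subset N) where
    private
      step-at : ∀ {u v cu cv} → cell X u ≡ cu → cell X v ≡ cv → unitAdj cu cv ≡ true → ToSpecial X v → ToSpecial X u
      step-at refl refl = step

      t→ : ToSpecial X (inj₁ (Fin.suc Fin.zero))
      t→ = step (adj-E 0 0) here

      neck₁→ : ToSpecial X (inj₂ (neck (Fin.suc Fin.zero)))
      neck₁→ = step (adj-NW 1 0) t→

      upperAt→ : ∀ n (h : n < M) → ToSpecial X (upperAt n h)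
      upperAt→ zero    h = step-at (upperAt-cell X 0 h) refl (adj-N 2 1) neck₁→
      upperAt→ (suc n) h =
        step-at (upperAt-cell X (suc n) h) (upperAt-cell X n n<M) (adj-E (2 ℕ.+ n) 2) (upperAt→ n n<M)
        where n<M = ℕP.<-trans (ℕP.n<1+n n) h

      lowerAt→ : ∀ n (h : n < M) → ToSpecial X (lowerAt n h)
      lowerAt→ n h = step-at (lowerAt-cell X n h) (upperAt-cell X n h) (adj-NW (2 ℕ.+ n) 2) (upperAt→ n h)

      via-index : ∀ {P : Fin M → Set} → (∀ n (h : n < M) → P (fromℕ< h)) → ∀ j → P j
      via-index {P} f j = subst P (FinP.fromℕ<-toℕ j (FinP.toℕ<n j)) (f (toℕ j) (FinP.toℕ<n j))

      gadget→ : ∀ i k → ToSpecial X (inj₂ (gadget i k))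
      gadget→ i = gadget-path (lookup X i) refl
        where
        x : ℕ
        x = offset i
        2+x<M : 2 ℕ.+ x < M
        2+x<M = s≤s (ℕP.≤-trans (ℕP.m≤n+m _ 2) (fourfold-mono (FinP.toℕ<n i)))
        gadget-cell : ∀ {b} → lookup X i ≡ b → ∀ k → cell X (inj₂ (gadget i k)) ≡ gadgetCell b k x
        gadget-cell i∈X k = cong (λ b → gadgetCell b k x) i∈X
        base-in : lookup X i ≡ true → ToSpecial X (inj₂ (gadget i base))
        base-in eq = step-at (gadget-cell eq base) (upperAt-cell X (2 ℕ.+ x) 2+x<M) (adj-S (4 ℕ.+ x) 1)
                             (upperAt→ (2 ℕ.+ x) 2+x<M)
        base-out : lookup X i ≡ false → ToSpecial X (inj₂ (gadget i base))
        base-out eq = step-at (gadget-cell eq base) (lowerAt-cell X (2 ℕ.+ x) 2+x<M) (adj-N (5 ℕ.+ x) 3)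
                              (lowerAt→ (2 ℕ.+ x) 2+x<M)
        side-out : lookup X i ≡ false → ToSpecial X (inj₂ (gadget i side))
        side-out eq = step-at (gadget-cell eq side) (gadget-cell eq base) (adj-N (5 ℕ.+ x) 4) (base-out eq)
        gadget-path : ∀ b → lookup X i ≡ b → ∀ k → ToSpecial X (inj₂ (gadget i k))
        gadget-path true  eq base = base-in eq
        gadget-path true  eq side = step-at (gadget-cell eq side) (gadget-cell eq base) (adj-E (4 ℕ.+ x) 1) (base-in eq)
        gadget-path true  eq tip  = step-at (gadget-cell eq tip) (gadget-cell eq base) (adj-S (4 ℕ.+ x) 0) (base-in eq)
        gadget-path false eq base = base-out eq
        gadget-path false eq side = side-out eq
        gadget-path false eq tip  = step-at (gadget-cell eq tip) (gadget-cell eq side) (adj-N (5 ℕ.+ x) 5) (side-out eq)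

    toSpecial : ∀ n → ToSpecial X n
    toSpecial (inj₁ Fin.zero)           = here
    toSpecial (inj₁ (Fin.suc Fin.zero)) = t→
    toSpecial (inj₂ (neck Fin.zero))    = step (adj-NW 0 0) here
    toSpecial (inj₂ (neck (Fin.suc Fin.zero))) = neck₁→
    toSpecial (inj₂ (upper j))          = via-index {λ j → ToSpecial X (inj₂ (upper j))} upperAt→ j
    toSpecial (inj₂ (lower j))          = via-index {λ j → ToSpecial X (inj₂ (lower j))} lowerAt→ j
    toSpecial (inj₂ (gadget i k))       = gadget→ i k

  glue-connected : ∀ A B → Connected (glue (G A) (G B))
  glue-connected A B = connected-via (glue (G A) (G B)) (inj₁ Fin.zero) to-s
    where
    Γ : Graph
    Γ = glue (G A) (G B)
    lift-left : ∀ {n} → ToSpecial A n → Walk Γ (left A B (vertex n)) (inj₁ Fin.zero)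
    lift-left here                  = here
    lift-left (step {u} {v} adj p) = step (left-unit A B u v adj) (lift-left p)
    lift-right : ∀ {n} → ToSpecial B n → Walk Γ (right A B (vertex n)) (inj₁ Fin.zero)
    lift-right here                  = here
    lift-right (step {u} {v} adj p) = step (right-unit A B u v adj) (lift-right p)
    to-s : ∀ w → Walk Γ w (inj₁ Fin.zero)
    to-s (inj₁ j)        = lift-left (toSpecial A (inj₁ j))
    to-s (inj₂ (inj₁ a)) = subst (λ w → Walk Γ w (inj₁ Fin.zero)) (cong (left A B) (vertex-node (inj₂ a)))
                                 (lift-left (toSpecial A (node (inj₂ a))))
    to-s (inj₂ (inj₂ b)) = subst (λ w → Walk Γ w (inj₁ Fin.zero)) (cong (right A B) (vertex-node (inj₂ b)))
                                 (lift-right (toSpecial B (node (inj₂ b))))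

module Neighbourhood (N : ℕ) where
  open import Axiom.UniquenessOfIdentityProofs using (module Decidable⇒UIP)
  import Data.Bool.Properties as BoolP
  open import Data.Sum.Properties using (inj₁-injective; inj₂-injective)
  open import Data.Sum.Function.Propositional using (_⊎-↔_)
  open import Function.Construct.Composition using (_↔-∘_; _↣-∘_)
  open import Function.Construct.Identity using (↔-id)
  open import Function.Construct.Symmetry using (↔-sym)
  open import Function.Properties.Inverse using (↔⇒↣)

  open Lattice using (unitAdj)
  open Construction
  open Family N

  open Decidable⇒UIP BoolP._≟_ using (≡-irrelevant)

  private
    NSV-≡ : ∀ {A B} {x y : NSV (G A) (G B)} → proj₁ x ≡ proj₁ y → x ≡ y
    NSV-≡ {x = v , p} {y = .v , q} refl = cong (v ,_) (≡-irrelevant p q)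

    code-injective : ∀ {a a′} → code a ≡ code a′ → a ≡ a′
    code-injective {a} {a′} eq =
      trans (sym (Inverse.strictlyInverseʳ code↔ a)) (trans (cong (Inverse.from code↔) eq) (Inverse.strictlyInverseʳ code↔ a′))

  -- N[S] consists of the specials and the two necks of each side, none of
  -- which depends on the sets A and B.
  inNS-isNeck : ∀ A B a → inNS (G A) (G B) (inj₂ (inj₁ a)) ≡ isNeck (code a)
  inNS-isNeck A B a = touches-special≡isNeck A (code a)

  inNS-isNeckʳ : ∀ A B b → inNS (G A) (G B) (inj₂ (inj₂ b)) ≡ isNeck (code b)
  inNS-isNeckʳ A B b = touches-special≡isNeck B (code b)

  inNS-stable : ∀ A B A′ B′ v → inNS (G A′) (G B′) v ≡ inNS (G A) (G B) v
  inNS-stable A B A′ B′ (inj₁ _)        = refl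
  inNS-stable A B A′ B′ (inj₂ (inj₁ a)) = trans (inNS-isNeck A′ B′ a) (sym (inNS-isNeck A B a))
  inNS-stable A B A′ B′ (inj₂ (inj₂ b)) = trans (inNS-isNeckʳ A′ B′ b) (sym (inNS-isNeckʳ A B b))

  neck-cell : ∀ X X′ c → isNeck c ≡ true → cellOf X′ c ≡ cellOf X c
  neck-cell X X′ (neck _)     _ = refl
  neck-cell X X′ (upper _)    ()
  neck-cell X X′ (lower _)    ()
  neck-cell X X′ (gadget _ _) ()

  private
    stableˡ : ∀ A B A′ a → inNS (G A) (G B) (inj₂ (inj₁ a)) ≡ true → cellOf A′ (code a) ≡ cellOf A (code a)
    stableˡ A B A′ a a∈NS = neck-cell A A′ (code a) (trans (sym (inNS-isNeck A B a)) a∈NS)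

    stableʳ : ∀ A B B′ b → inNS (G A) (G B) (inj₂ (inj₂ b)) ≡ true → cellOf B′ (code b) ≡ cellOf B (code b)
    stableʳ A B B′ b b∈NS = neck-cell B B′ (code b) (trans (sym (inNS-isNeckʳ A B b)) b∈NS)

  adj-stable : ∀ A B A′ B′ (x y : NSV (G A) (G B)) →
               gAdj (G A′) (G B′) (proj₁ x) (proj₁ y) ≡ gAdj (G A) (G B) (proj₁ x) (proj₁ y)
  adj-stable A B A′ B′ (inj₁ i , _)        (inj₁ j , _)        = refl
  adj-stable A B A′ B′ (inj₁ i , _)        (inj₂ (inj₁ a) , p) = cong (unitAdj _) (stableˡ A B A′ a p)
  adj-stable A B A′ B′ (inj₁ i , _)        (inj₂ (inj₂ b) , p) = cong (unitAdj _) (stableʳ A B B′ b p)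
  adj-stable A B A′ B′ (inj₂ (inj₁ a) , p) (inj₁ j , _)        = cong (λ c → unitAdj c _) (stableˡ A B A′ a p)
  adj-stable A B A′ B′ (inj₂ (inj₂ b) , p) (inj₁ j , _)        = cong (λ c → unitAdj c _) (stableʳ A B B′ b p)
  adj-stable A B A′ B′ (inj₂ (inj₁ a) , p) (inj₂ (inj₁ a′) , q) = cong₂ unitAdj (stableˡ A B A′ a p) (stableˡ A B A′ a′ q)
  adj-stable A B A′ B′ (inj₂ (inj₂ b) , p) (inj₂ (inj₂ b′) , q) = cong₂ unitAdj (stableʳ A B B′ b p) (stableʳ A B B′ b′ q)
  adj-stable A B A′ B′ (inj₂ (inj₁ a) , _) (inj₂ (inj₂ b) , _) = refl
  adj-stable A B A′ B′ (inj₂ (inj₂ b) , _) (inj₂ (inj₁ a) , _) = refl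

  neighbourhood-iso : ∀ A B A′ B′ → NSIso (G A) (G B) (G A′) (G B′)
  neighbourhood-iso A B A′ B′ =
    mk↔ₛ′ to from (λ _ → NSV-≡ refl) (λ _ → NSV-≡ refl) , adj-stable A B A′ B′ , λ _ → refl
    where
    to : NSV (G A) (G B) → NSV (G A′) (G B′)
    to (v , v∈NS) = v , trans (inNS-stable A B A′ B′ v) v∈NS
    from : NSV (G A′) (G B′) → NSV (G A) (G B)
    from (v , v∈NS) = v , trans (inNS-stable A′ B′ A B v) v∈NS

  private
    neckIndex : ∀ c → isNeck c ≡ true → Fin 2
    neckIndex (neck j) _ = j

    neckIndex-injective : ∀ c c′ p p′ → neckIndex c p ≡ neckIndex c′ p′ → c ≡ c′
    neckIndex-injective (neck _) (neck _) _ _ refl = refl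

    isNeckˡ : ∀ A B a → inNS (G A) (G B) (inj₂ (inj₁ a)) ≡ true → isNeck (code a) ≡ true
    isNeckˡ A B a a∈NS = trans (sym (inNS-isNeck A B a)) a∈NS

    isNeckʳ : ∀ A B b → inNS (G A) (G B) (inj₂ (inj₂ b)) ≡ true → isNeck (code b) ≡ true
    isNeckʳ A B b b∈NS = trans (sym (inNS-isNeckʳ A B b)) b∈NS

    Slot : Set
    Slot = Fin 2 ⊎ (Fin 2 ⊎ Fin 2)

    slot↔ : Fin 6 ↔ Slot
    slot↔ = (↔-id (Fin 2) ⊎-↔ FinP.+↔⊎) ↔-∘ FinP.+↔⊎

    module _ (A B : Subset N) where
      slot : NSV (G A) (G B) → Slot
      slot (inj₁ j , _)            = inj₁ j
      slot (inj₂ (inj₁ a) , a∈NS) = inj₂ (inj₁ (neckIndex (code a) (isNeckˡ A B a a∈NS)))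
      slot (inj₂ (inj₂ b) , b∈NS) = inj₂ (inj₂ (neckIndex (code b) (isNeckʳ A B b b∈NS)))

      slot-injective : ∀ {x y} → slot x ≡ slot y → x ≡ y
      slot-injective {inj₁ _ , _}        {inj₁ _ , _}        refl = NSV-≡ refl
      slot-injective {inj₂ (inj₁ a) , p} {inj₂ (inj₁ a′) , q} eq =
        NSV-≡ (cong (λ a → inj₂ (inj₁ a)) (code-injective (neckIndex-injective _ _ _ _ (inj₁-injective (inj₂-injective eq)))))
      slot-injective {inj₂ (inj₂ b) , p} {inj₂ (inj₂ b′) , q} eq =
        NSV-≡ (cong (λ b → inj₂ (inj₂ b)) (code-injective (neckIndex-injective _ _ _ _ (inj₂-injective (inj₂-injective eq)))))
      slot-injective {inj₁ _ , _}        {inj₂ (inj₁ _) , _} ()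
      slot-injective {inj₁ _ , _}        {inj₂ (inj₂ _) , _} ()
      slot-injective {inj₂ (inj₁ _) , _} {inj₁ _ , _}        ()
      slot-injective {inj₂ (inj₁ _) , _} {inj₂ (inj₂ _) , _} ()
      slot-injective {inj₂ (inj₂ _) , _} {inj₁ _ , _}        ()
      slot-injective {inj₂ (inj₂ _) , _} {inj₂ (inj₁ _) , _} ()

  neighbourhood↣ : ∀ A B → NSV (G A) (G B) ↣ Fin 6
  neighbourhood↣ A B = ↔⇒↣ (↔-sym slot↔) ↣-∘ mk↣ (slot-injective A B)

module GraphSize where
  open import Data.Nat.Base using (_≤_; _^_)
  open import Data.Nat.Solver using (module +-*-Solver)

  open Construction

  fourfold≡4* : ∀ n → fourfold n ≡ 4 ℕ.* n
  fourfold≡4* zero    = refl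
  fourfold≡4* (suc n) = trans (cong (4 ℕ.+_) (fourfold≡4* n)) (sym (ℕP.*-suc 4 n))

  glue-size : ∀ N A B → Graph.size (glue (Family.G N A) (Family.G N B)) ≡ 10 ℕ.+ 22 ℕ.* N
  glue-size N A B rewrite fourfold≡4* N =
    solve 1 (λ n → con 2 :+ (:m n :+ :m n) := con 10 :+ con 22 :* n) refl N
    where
    open +-*-Solver
    :m : ∀ {k} → Polynomial k → Polynomial k
    :m n = con 2 :+ ((con 1 :+ con 4 :* n) :+ (con 1 :+ con 4 :* n)) :+ n :* con 3

  glue-size-bound : ∀ N A B → 0 < N → Graph.size (glue (Family.G N A) (Family.G N B)) ^ 1 ≤ 32 ^ 1 ℕ.* N
  glue-size-bound N A B 0<N = begin
    Graph.size (glue (Family.G N A) (Family.G N B)) ^ 1  ≡⟨ ℕP.*-identityʳ _ ⟩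
    Graph.size (glue (Family.G N A) (Family.G N B))      ≡⟨ glue-size N A B ⟩
    10 ℕ.+ 22 ℕ.* N                                      ≤⟨ ℕP.+-monoˡ-≤ (22 ℕ.* N) (ℕP.*-monoʳ-≤ 10 0<N) ⟩
    10 ℕ.* N ℕ.+ 22 ℕ.* N                                ≡⟨ sym (ℕP.*-distribʳ-+ N 10 22) ⟩
    32 ℕ.* N                                             ∎
    where open ℕP.≤-Reasoning

open Construction using (module Family)
open GraphSize using (glue-size-bound)
open Connectivity using (glue-connected)
open Neighbourhood using (neighbourhood-iso; neighbourhood↣)
open Realisation using (unitDistance⇒disjoint; disjoint⇒unitDistance)

theorem5p3 : (ℝ : CompleteOrderedField) → DisjointnessExpressing (IsUnitDistance ℝ) 6 1
theorem5p3 ℝ = 32 , s≤s z≤n , λ N 0<N → 2 , Family.G N , Family.G N , λ A B →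
  (glue-connected N A B , glue-size-bound N A B 0<N) ,
  ((λ A′ B′ → neighbourhood-iso N A B A′ B′) , neighbourhood↣ N A B) ,
  mk⇔ (unitDistance⇒disjoint ℝ N A B) (disjoint⇒unitDistance ℝ N A B)
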